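{- Let $v\in\mathcal{S}_d$ be any pattern and fix an integer $\ell\ge 2$. For $n\in\mathbb{N}_0$ let $a_n:=\dfrac{g_0^v(\mathcal{S}_{n+d-1})}{(n+d-1)!}$, and let $$\beta_{\ell-1}(v):=a_{\ell-1}-a_\ell=\frac{g_0^v(\mathcal{S}_{\ell+d-2})}{(\ell+d-2)!}-\frac{g_0^v(\mathcal{S}_{\ell+d-1})}{(\ell+d-1)!}.$$ Then for every integer $n>\ell+2d$, $$0\le a_n-a_{n-1}+\beta_{\ell-1}(v)\,a_{n-\ell-d+1}\le \frac{d-1}{d!}\,a_{n-\ell-2d+2}.$$
   Context: $\mathcal{S}_m$ is the set of permutations of $\{1,\dots,m\}$ written as words $\sigma_1\cdots\sigma_m$. For $v\in\mathcal{S}_d$, a consecutive occurrence of $v$ in $\sigma$ is an index $j$, $1\le j\le m-d+1$, such that $\sigma_j\cdots\sigma_{j+d-1}$ is order-isomorphic to $v$ (i.e. $\sigma_{j+p-1}<\sigma_{j+q-1}\iff v_p<v_q$ for all $p,q$). $g_0^v(\mathcal{S}_m)$ is the number of $\sigma\in\mathcal{S}_m$ with no consecutive occurrence of $v$. -}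

module Defs where

open import Data.Nat using (ℕ; zero; suc; _+_; _∸_; _<ᵇ_; _≤ᵇ_; _≡ᵇ_)
open import Data.Nat.Combinatorics using ()
open import Data.Nat.Base using (_!)
open import Data.Nat.Properties using (_!≢0)
open import Data.Bool using (Bool; true; false; _∧_; _∨_; not; if_then_else_)
open import Data.Fin using (Fin; toℕ)
open import Data.List using (List; []; _∷_; allFin; filterᵇ; length; upTo; map; concatMap)
open import Data.Bool.ListAction using (all; any)
open import Data.Vec using (Vec; []; _∷_; lookup)
import Data.Vec as V
open import Data.Fin.Permutation using (Permutation′; _⟨$⟩ʳ_)
open import Data.Integer using (+_)
open import Data.Rational using (ℚ; _/_)

_==_ : Bool → Bool → Bool
true  == b = b
false == b = not b

allVecs : (k m : ℕ) → List (Vec (Fin m) k)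
allVecs zero    m = [] ∷ []
allVecs (suc k) m = concatMap (λ i → map (i ∷_) (allVecs k m)) (allFin m)

isPermᵇ : ∀ {m} → Vec (Fin m) m → Bool
isPermᵇ {m} σ = all (λ i → all (λ j → (toℕ i ≡ᵇ toℕ j) ∨ not (toℕ (lookup σ i) ≡ᵇ toℕ (lookup σ j))) (allFin m)) (allFin m)

-- the word σ as values, indexed from 0 (default 0 out of range; never used there)
nth : ∀ {m} → Vec (Fin m) m → ℕ → ℕ
nth σ i = go (V.toList σ) i
  where
  go : ∀ {m} → List (Fin m) → ℕ → ℕ
  go []       _       = 0
  go (x ∷ xs) zero    = toℕ x
  go (x ∷ xs) (suc i) = go xs i

-- consecutive occurrence of v at (0-based) position j: σ_{j+p} < σ_{j+q} ⇔ v_p < v_q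
occursAtᵇ : ∀ {m d} → Vec (Fin m) m → Permutation′ d → ℕ → Bool
occursAtᵇ {m} {d} σ v j =
  all (λ p → all (λ q →
        (nth σ (j + toℕ p) <ᵇ nth σ (j + toℕ q)) == (toℕ (v ⟨$⟩ʳ p) <ᵇ toℕ (v ⟨$⟩ʳ q)))
      (allFin d)) (allFin d)

containsᵇ : ∀ {m d} → Vec (Fin m) m → Permutation′ d → Bool
containsᵇ {m} {d} σ v = (d ≤ᵇ m) ∧ any (occursAtᵇ σ v) (upTo (suc (m ∸ d)))

g0 : ∀ {d} → Permutation′ d → ℕ → ℕ
g0 v m = length (filterᵇ (λ σ → isPermᵇ σ ∧ not (containsᵇ σ v)) (allVecs m m))

a : ∀ {d} → Permutation′ d → ℕ → ℚ
a {d} v n = _/_ (+ g0 v (n + d ∸ 1)) ((n + d ∸ 1) !) {{(n + d ∸ 1) !≢0}}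

β : ∀ {d} → Permutation′ d → ℕ → ℚ
β v ℓ = a v (ℓ ∸ 1) Data.Rational.- a v ℓ

{-# OPTIONS --safe #-}

-- For m ≥ x + d − 1, a_x is the probability that a uniform σ ∈ S_m has no occurrence of v
-- starting at the first x positions: the standardisation of a block of a uniform permutation
-- is uniform and independent of everything before the block. Write n = w₁ + (d − 1) + ℓ, so
-- that w₁ = n − ℓ − d + 1, and take m = n + d − 1. Then a_{n−1} − a_n = P(F) for the event F
-- that the first occurrence starts at the last position, and β_{ℓ−1}(v) a_{w₁} = P(G) for the
-- event G that the first w₁ positions are free and the final block, of length ℓ + d − 1, has
-- its first occurrence at its last position. F implies G, and G without F forces an occurrence
-- at one of the d − 1 gap positions w₁, …, w₁ + d − 2 while the first w₂ = w₁ − d + 1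
-- positions are free; by independence again each of these d − 1 events has probability at
-- most a_{w₂}/d!. So the quantity of the theorem, P(G) − P(F), lies in [0, (d − 1) a_{w₂}/d!].

module Submission where

open import Data.Bool.Base using (Bool; true; false; T; not; _∧_; _∨_)
open import Data.Bool.ListAction using (and; all; any)
open import Data.Bool.Properties using (T-≡; T-∧; ∧-assoc; ∧-comm; ∧-identityʳ; ∧-zeroʳ)
open import Data.Empty using (⊥; ⊥-elim)
open import Data.Fin.Base as Fin using (Fin; toℕ)
open import Data.Fin.Permutation using (Permutation′; _⟨$⟩ʳ_; _⟨$⟩ˡ_; inverseˡ)
import Data.Fin.Properties as Fin
import Data.Integer.Base as ℤ
import Data.Integer.Properties as ℤ
open import Data.List.Base as List using (List; []; _∷_; _++_; map; length; filterᵇ; concatMap; cartesianProductWith; upTo; allFin)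
open import Data.List.Membership.Propositional using (_∈_)
open import Data.List.Membership.Propositional.Properties
  using (∈-upTo⁺; ∈-upTo⁻; ∈-map⁺; ∈-map⁻; ∈-filter⁺; ∈-filter⁻; ∈-allFin; ∈-cartesianProductWith⁺)
open import Data.List.Membership.Propositional.Properties.WithK using (unique∧set⇒bag)
open import Data.List.Properties
  using (map-cong; map-tabulate; length-upTo; map-∘; map-++; length-map; map-id-local; length-tabulate)
open import Data.List.Relation.Binary.BagAndSetEquality using (∼bag⇒↭)
open import Data.List.Relation.Binary.Permutation.Propositional.Properties using (↭-length)
open import Data.List.Relation.Unary.All as All using (All)
open import Data.List.Relation.Unary.All.Properties using (all⁺; all⁻)
import Data.List.Relation.Unary.AllPairs as AllPairs
open import Data.List.Relation.Unary.Any as Any using (here; there)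
open import Data.List.Relation.Unary.Any.Properties using (any⁺)
open import Data.List.Relation.Unary.Unique.Propositional using (Unique)
import Data.List.Relation.Unary.Unique.Propositional.Properties as Unique
open import Data.Nat.Base using (ℕ; zero; suc; pred; NonZero; s≤s⁻¹; _+_; _*_; _∸_; _≤_; _<_; z≤n; s≤s; _≡ᵇ_; _<ᵇ_; _!)
open import Data.Nat.ListAction using (sum)
open import Data.Nat.ListAction.Properties using (sum-++)
open import Data.Nat.Properties
open import Algebra.Properties.CommutativeSemigroup +-commutativeSemigroup using () renaming (interchange to +-interchange)
open import Data.Nat.Solver using (module +-*-Solver)
open import Data.Product.Base using (∃; _×_; _,_; proj₁; proj₂; uncurry)
open import Data.Rational.Base as ℚ using (ℚ; 0ℚ; 1ℚ; _/_)
import Data.Rational.Properties as ℚ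
open import Data.Rational.Solver using () renaming (module +-*-Solver to ℚ-Solver)
open import Data.Rational.Unnormalised.Base as ℚᵘ using (ℚᵘ; mkℚᵘ; *≡*; *≤*)
import Data.Rational.Unnormalised.Properties as ℚᵘ
open import Data.Unit.Base using (tt)
open import Data.Vec.Base as Vec using (Vec; []; _∷_; lookup)
import Data.Vec.Properties as Vec
open import Defs
open import Function.Base using (_∘_; case_of_)
open import Function.Bundles using (Equivalence; mk⇔; _⇔_)
open import Function.Definitions using (Injective)
open import Relation.Binary.Definitions using (DecidableEquality; tri<; tri≈; tri>)
open import Relation.Binary.PropositionalEquality
open import Relation.Nullary.Decidable using (T?; yes; no; isYes; toWitness; fromWitness)
open import Relation.Nullary.Negation using (¬_)

private
  variable
    A B : Set

∑ : (A → ℕ) → List A → ℕ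
∑ f xs = sum (map f xs)

∑-cong : {f g : A → ℕ} (xs : List A) → (∀ {x} → x ∈ xs → f x ≡ g x) → ∑ f xs ≡ ∑ g xs
∑-cong []       eq = refl
∑-cong (x ∷ xs) eq = cong₂ _+_ (eq (here refl)) (∑-cong xs (eq ∘ there))

∑-mono-≤ : {f g : A → ℕ} (xs : List A) → (∀ {x} → x ∈ xs → f x ≤ g x) → ∑ f xs ≤ ∑ g xs
∑-mono-≤ []       le = z≤n
∑-mono-≤ (x ∷ xs) le = +-mono-≤ (le (here refl)) (∑-mono-≤ xs (le ∘ there))

∑-mono-< : {f g : A → ℕ} {xs : List A} {y : A} → (∀ {x} → x ∈ xs → f x ≤ g x) → y ∈ xs → f y < g y → ∑ f xs < ∑ g xs
∑-mono-< {xs = x ∷ xs} le (here refl) lt = +-mono-<-≤ lt (∑-mono-≤ xs (le ∘ there))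
∑-mono-< {xs = x ∷ xs} le (there y∈) lt = +-mono-≤-< (le (here refl)) (∑-mono-< (le ∘ there) y∈ lt)

∑-+ : (f g : A → ℕ) (xs : List A) → ∑ (λ x → f x + g x) xs ≡ ∑ f xs + ∑ g xs
∑-+ f g []       = refl
∑-+ f g (x ∷ xs) = trans (cong (f x + g x +_) (∑-+ f g xs)) (+-interchange (f x) (g x) (∑ f xs) (∑ g xs))

∑-++ : (f : A → ℕ) (xs ys : List A) → ∑ f (xs ++ ys) ≡ ∑ f xs + ∑ f ys
∑-++ f xs ys = trans (cong sum (map-++ f xs ys)) (sum-++ (map f xs) (map f ys))

∑-map : (f : B → ℕ) (g : A → B) (xs : List A) → ∑ f (map g xs) ≡ ∑ (f ∘ g) xs
∑-map f g xs = cong sum (sym (map-∘ xs))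

∑-concatMap : (f : B → ℕ) (h : A → List B) (xs : List A) → ∑ f (concatMap h xs) ≡ ∑ (∑ f ∘ h) xs
∑-concatMap f h []       = refl
∑-concatMap f h (x ∷ xs) = trans (∑-++ f (h x) (concatMap h xs)) (cong (∑ f (h x) +_) (∑-concatMap f h xs))

∑-const : (c : ℕ) (xs : List A) → ∑ (λ _ → c) xs ≡ length xs * c
∑-const c []       = refl
∑-const c (x ∷ xs) = cong (c +_) (∑-const c xs)

∑-0 : (xs : List A) → ∑ (λ _ → 0) xs ≡ 0
∑-0 xs = trans (∑-const 0 xs) (*-zeroʳ (length xs))

∑-*ʳ : (f : A → ℕ) (c : ℕ) (xs : List A) → ∑ (λ x → f x * c) xs ≡ ∑ f xs * c
∑-*ʳ f c []       = refl
∑-*ʳ f c (x ∷ xs) = trans (cong (f x * c +_) (∑-*ʳ f c xs)) (sym (*-distribʳ-+ c (f x) (∑ f xs)))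

∑-upTo-*-≤ : (f : ℕ → ℕ) (c b n : ℕ) → (∀ {j} → j < n → f j * c ≤ b) → ∑ f (upTo n) * c ≤ n * b
∑-upTo-*-≤ f c b n bound = begin
  ∑ f (upTo n) * c              ≡⟨ ∑-*ʳ f c (upTo n) ⟨
  ∑ (λ j → f j * c) (upTo n)    ≤⟨ ∑-mono-≤ (upTo n) (bound ∘ ∈-upTo⁻) ⟩
  ∑ (λ _ → b) (upTo n)          ≡⟨ ∑-const b (upTo n) ⟩
  length (upTo n) * b           ≡⟨ cong (_* b) (length-upTo n) ⟩
  n * b                         ∎
  where open ≤-Reasoning

T-injective : {a b : Bool} → (T a ⇔ T b) → a ≡ b
T-injective {true}  {true}  _   = refl
T-injective {true}  {false} a⇔b = ⊥-elim (Equivalence.to a⇔b tt)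
T-injective {false} {true}  a⇔b = ⊥-elim (Equivalence.from a⇔b tt)
T-injective {false} {false} _   = refl

<ᵇ-cong : {a b c d : ℕ} → (a < b ⇔ c < d) → (a <ᵇ b) ≡ (c <ᵇ d)
<ᵇ-cong {a} {b} {c} {d} equiv = T-injective (mk⇔ (<⇒<ᵇ ∘ Equivalence.to equiv ∘ <ᵇ⇒< a b)
                                                  (<⇒<ᵇ ∘ Equivalence.from equiv ∘ <ᵇ⇒< c d))

T-∨-not : {a b : Bool} → T (a ∨ not b) ⇔ (T b → T a)
T-∨-not {true}          = mk⇔ (λ _ _ → tt) (λ _ → tt)
T-∨-not {false} {true}  = mk⇔ (λ ()) (λ h → h tt)
T-∨-not {false} {false} = mk⇔ (λ _ ()) (λ _ → tt)

T-≡ᵇ-Fin : {n : ℕ} {i j : Fin n} → T (toℕ i ≡ᵇ toℕ j) ⇔ i ≡ j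
T-≡ᵇ-Fin {i = i} {j} = mk⇔ (Fin.toℕ-injective ∘ ≡ᵇ⇒≡ (toℕ i) (toℕ j)) (≡⇒≡ᵇ (toℕ i) (toℕ j) ∘ cong toℕ)

T-all-allFin : {n : ℕ} {p : Fin n → Bool} → T (all p (allFin n)) ⇔ (∀ i → T (p i))
T-all-allFin {n} {p} = mk⇔ (λ h i → All.lookup (all⁺ p (allFin n) h) (∈-allFin i))
                           (λ h → all⁻ p {xs = allFin n} (All.tabulate (λ {i} _ → h i)))

boolToℕ : Bool → ℕ
boolToℕ true  = 1
boolToℕ false = 0

count : (A → Bool) → List A → ℕ
count p = ∑ (boolToℕ ∘ p)

length-filterᵇ : (p : A → Bool) (xs : List A) → length (filterᵇ p xs) ≡ count p xs
length-filterᵇ p []       = refl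
length-filterᵇ p (x ∷ xs) with p x
... | true  = cong suc (length-filterᵇ p xs)
... | false = length-filterᵇ p xs

count-filterᵇ : (p q : A → Bool) (xs : List A) → count q (filterᵇ p xs) ≡ count (λ x → p x ∧ q x) xs
count-filterᵇ p q []       = refl
count-filterᵇ p q (x ∷ xs) with p x
... | true  = cong (boolToℕ (q x) +_) (count-filterᵇ p q xs)
... | false = count-filterᵇ p q xs

boolToℕ-mono : {a b : Bool} → (T a → T b) → boolToℕ a ≤ boolToℕ b
boolToℕ-mono {false}         _ = z≤n
boolToℕ-mono {true}  {true}  _ = ≤-refl
boolToℕ-mono {true}  {false} h = ⊥-elim (h tt)

boolToℕ-mono-< : {a b : Bool} → ¬ T a → T b → boolToℕ a < boolToℕ b
boolToℕ-mono-< {false} {true} _ _ = s≤s z≤n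
boolToℕ-mono-< {true}         h _ = ⊥-elim (h tt)

boolToℕ-∧-not : (a b : Bool) → boolToℕ a ≡ boolToℕ (a ∧ b) + boolToℕ (a ∧ not b)
boolToℕ-∧-not true  true  = refl
boolToℕ-∧-not true  false = refl
boolToℕ-∧-not false _     = refl

boolToℕ-∨ : (a b : Bool) → boolToℕ (a ∨ b) ≤ boolToℕ a + boolToℕ b
boolToℕ-∨ true  _ = s≤s z≤n
boolToℕ-∨ false _ = ≤-refl

count-cong : {p q : A → Bool} (xs : List A) → (∀ {x} → x ∈ xs → p x ≡ q x) → count p xs ≡ count q xs
count-cong xs eq = ∑-cong xs (cong boolToℕ ∘ eq)

count-mono : {p q : A → Bool} (xs : List A) → (∀ {x} → x ∈ xs → T (p x) → T (q x)) → count p xs ≤ count q xs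
count-mono xs imp = ∑-mono-≤ xs (boolToℕ-mono ∘ imp)

count-mono-< : {p q : A → Bool} {xs : List A} {y : A} → (∀ {x} → x ∈ xs → T (p x) → T (q x)) →
               y ∈ xs → ¬ T (p y) → T (q y) → count p xs < count q xs
count-mono-< imp y∈ ¬py qy = ∑-mono-< (boolToℕ-mono ∘ imp) y∈ (boolToℕ-mono-< ¬py qy)

count-true : (xs : List A) → count (λ _ → true) xs ≡ length xs
count-true xs = trans (∑-const 1 xs) (*-identityʳ (length xs))

count-∧-not : (p q : A → Bool) (xs : List A) →
              count p xs ≡ count (λ x → p x ∧ q x) xs + count (λ x → p x ∧ not (q x)) xs
count-∧-not p q xs = trans (∑-cong xs (λ {x} _ → boolToℕ-∧-not (p x) (q x))) (∑-+ _ _ xs)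

count-∨ : (p q : A → Bool) (xs : List A) → count (λ x → p x ∨ q x) xs ≤ count p xs + count q xs
count-∨ p q xs = ≤-trans (∑-mono-≤ xs (λ {x} _ → boolToℕ-∨ (p x) (q x))) (≤-reflexive (∑-+ _ _ xs))

count-const-∧ : (c : Bool) (p : A → Bool) (xs : List A) → count (λ x → c ∧ p x) xs ≡ boolToℕ c * count p xs
count-const-∧ true  p xs = sym (+-identityʳ _)
count-const-∧ false p xs = ∑-0 xs

count-any : {C : Set} (P : C → A → Bool) (js : List C) (xs : List A) →
            count (λ x → any (λ j → P j x) js) xs ≤ ∑ (λ j → count (P j) xs) js
count-any P []       xs = ≤-reflexive (∑-0 xs)
count-any P (j ∷ js) xs = ≤-trans (count-∨ (P j) _ xs) (+-monoʳ-≤ (count (P j) xs) (count-any P js xs))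

module _ (_≟_ : DecidableEquality B) where

  count-≟-unique : {ys : List B} {y : B} → Unique ys → y ∈ ys → count (λ y′ → isYes (y ≟ y′)) ys ≡ 1
  count-≟-unique {y ∷ ys} (y∉ AllPairs.∷ _) (here refl) with y ≟ y
  ... | yes _   = cong suc (count-≟-none y∉)
    where
    count-≟-none : {zs : List B} → All (y ≢_) zs → count (λ y′ → isYes (y ≟ y′)) zs ≡ 0
    count-≟-none All.[]         = refl
    count-≟-none {z ∷ _} (y≢z All.∷ y∉zs) with y ≟ z
    ... | yes y≡z = ⊥-elim (y≢z y≡z)
    ... | no  _   = count-≟-none y∉zs
  ... | no  y≢y = ⊥-elim (y≢y refl)
  count-≟-unique {y₀ ∷ ys} {y} (y₀∉ AllPairs.∷ !ys) (there y∈) with y ≟ y₀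
  ... | yes refl = ⊥-elim (All.lookup y₀∉ y∈ refl)
  ... | no  _    = count-≟-unique !ys y∈

  count-fibres : (h : A → B) (P : A → Bool) (xs : List A) {ys : List B} → Unique ys → (∀ {x} → x ∈ xs → T (P x) → h x ∈ ys) →
                 count P xs ≡ ∑ (λ y → count (λ x → P x ∧ isYes (h x ≟ y)) xs) ys
  count-fibres h P []       {ys} _   _  = sym (∑-0 ys)
  count-fibres h P (x ∷ xs) {ys} !ys hx∈ = begin
    boolToℕ (P x) + count P xs
      ≡⟨ cong₂ _+_ fibre-of-x (count-fibres h P xs !ys (hx∈ ∘ there)) ⟩
    count (λ y → P x ∧ isYes (h x ≟ y)) ys + ∑ (λ y → count (λ x → P x ∧ isYes (h x ≟ y)) xs) ys
      ≡⟨ ∑-+ _ _ ys ⟨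
    ∑ (λ y → count (λ x → P x ∧ isYes (h x ≟ y)) (x ∷ xs)) ys
      ∎
    where
    open ≡-Reasoning
    fibre-of-x : boolToℕ (P x) ≡ count (λ y → P x ∧ isYes (h x ≟ y)) ys
    fibre-of-x with P x in Px
    ... | true  = sym (count-≟-unique !ys (hx∈ (here refl) (Equivalence.from T-≡ Px)))
    ... | false = sym (∑-0 ys)

count-bijection : {xs : List A} {ys : List B} → Unique xs → Unique ys →
  (p : A → Bool) (q : B → Bool) (f : A → B) (g : B → A) →
  (∀ {x} → x ∈ xs → T (p x) → f x ∈ ys × T (q (f x))) →
  (∀ {y} → y ∈ ys → T (q y) → g y ∈ xs × T (p (g y))) →
  (∀ {x} → x ∈ xs → T (p x) → g (f x) ≡ x) →
  (∀ {y} → y ∈ ys → T (q y) → f (g y) ≡ y) →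
  count p xs ≡ count q ys
count-bijection {xs = xs} {ys} !xs !ys p q f g to from gf fg = begin
  count p xs                       ≡⟨ length-filterᵇ p xs ⟨
  length (filterᵇ p xs)            ≡⟨ length-map f (filterᵇ p xs) ⟨
  length (map f (filterᵇ p xs))    ≡⟨ ↭-length (∼bag⇒↭ (unique∧set⇒bag !image !q-ys (mk⇔ image⊆ ⊆image))) ⟩
  length (filterᵇ q ys)            ≡⟨ length-filterᵇ q ys ⟩
  count q ys                       ∎
  where
  open ≡-Reasoning
  filtered : ∀ {C : Set} (r : C → Bool) {zs} {z} → z ∈ filterᵇ r zs → z ∈ zs × T (r z)
  filtered r = ∈-filter⁻ (T? ∘ r)
  !q-ys : Unique (filterᵇ q ys)
  !q-ys = Unique.filter⁺ (T? ∘ q) !ys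
  !image : Unique (map f (filterᵇ p xs))
  !image = Unique.map⁻ {f = g} (subst Unique (sym (trans (sym (map-∘ (filterᵇ p xs)))
             (map-id-local (All.tabulate (λ z∈ → let (x∈ , px) = filtered p z∈ in gf x∈ px)))))
             (Unique.filter⁺ (T? ∘ p) !xs))
  image⊆ : ∀ {y} → y ∈ map f (filterᵇ p xs) → y ∈ filterᵇ q ys
  image⊆ y∈ with x , x∈ , refl ← ∈-map⁻ f y∈ =
    let (fx∈ , qfx) = uncurry to (filtered p x∈) in ∈-filter⁺ (T? ∘ q) fx∈ qfx
  ⊆image : ∀ {y} → y ∈ filterᵇ q ys → y ∈ map f (filterᵇ p xs)
  ⊆image y∈ = let (y∈ys , qy) = filtered q y∈ ; (gy∈ , pgy) = from y∈ys qy in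
    subst (_∈ map f (filterᵇ p xs)) (fg y∈ys qy) (∈-map⁺ f (∈-filter⁺ (T? ∘ p) gy∈ pgy))

injective⇒surjective : {n : ℕ} {f : Fin n → Fin n} → Injective _≡_ _≡_ f → ∀ y → ∃ λ x → f x ≡ y
injective⇒surjective {n} {f} inj y with Fin.any? (λ x → f x Fin.≟ y)
... | yes hit = hit
... | no  miss = ⊥-elim (missed-value n f y inj (λ x eq → miss (x , eq)))
  where
  missed-value : ∀ n (f : Fin n → Fin n) (y : Fin n) → Injective _≡_ _≡_ f → (∀ x → f x ≢ y) → ⊥
  missed-value (suc n) f y inj f≢y = <-irrefl refl (Fin.injective⇒≤ {f = squeezed}
    (λ eq → inj (Fin.punchOut-injective (f≢y _ ∘ sym) (f≢y _ ∘ sym) eq)))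
    where
    squeezed : Fin (suc n) → Fin n
    squeezed x = Fin.punchOut {i = y} {j = f x} (f≢y x ∘ sym)

count-∘-injective : {n : ℕ} (p : Fin n → Bool) {f : Fin n → Fin n} → Injective _≡_ _≡_ f →
                    count (p ∘ f) (allFin n) ≡ count p (allFin n)
count-∘-injective p {f} inj = count-bijection (Unique.allFin⁺ _) (Unique.allFin⁺ _) (p ∘ f) p f f⁻¹
  (λ {x} _ px → ∈-allFin (f x) , px)
  (λ {y} _ py → ∈-allFin (f⁻¹ y) , subst (T ∘ p) (sym (f∘f⁻¹ y)) py)
  (λ {x} _ _ → inj (f∘f⁻¹ (f x)))
  (λ {y} _ _ → f∘f⁻¹ y)
  where
  f⁻¹ = λ y → proj₁ (injective⇒surjective inj y)
  f∘f⁻¹ = λ y → proj₂ (injective⇒surjective inj y)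

count-<-allFin : {n : ℕ} (y : Fin n) → count (λ q → toℕ q <ᵇ toℕ y) (allFin n) ≡ toℕ y
count-<-allFin {suc n} Fin.zero    = count-false (allFin (suc n))
  where
  count-false : (xs : List (Fin (suc n))) → count (λ q → toℕ q <ᵇ 0) xs ≡ 0
  count-false []       = refl
  count-false (_ ∷ xs) = count-false xs
count-<-allFin {suc n} (Fin.suc y) = cong suc (begin
  count below (List.tabulate {n = n} Fin.suc)  ≡⟨ cong (count below) (sym (map-tabulate {n = n} (λ i → i) Fin.suc)) ⟩
  count below (map Fin.suc (allFin n))         ≡⟨ ∑-map (boolToℕ ∘ below) Fin.suc (allFin n) ⟩
  count (below ∘ Fin.suc) (allFin n)           ≡⟨ count-<-allFin y ⟩
  toℕ y                                        ∎)
  where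
  open ≡-Reasoning
  below : Fin (suc n) → Bool
  below q = toℕ q <ᵇ suc (toℕ y)

map-toℕ-allFin : (n : ℕ) → map toℕ (allFin n) ≡ upTo n
map-toℕ-allFin n = trans (map-tabulate (λ i → i) toℕ) (tabulate-toℕ n (λ i → i))
  where
  tabulate-toℕ : (n : ℕ) (f : ℕ → ℕ) → List.tabulate {n = n} (f ∘ toℕ) ≡ List.applyUpTo f n
  tabulate-toℕ zero    f = refl
  tabulate-toℕ (suc n) f = cong (f 0 ∷_) (tabulate-toℕ n (f ∘ suc))

-- Permutations as injective words

vec-ext : {n : ℕ} {u v : Vec A n} → (∀ i → lookup u i ≡ lookup v i) → u ≡ v
vec-ext {u = u} {v} eq = trans (sym (Vec.tabulate∘lookup u)) (trans (Vec.tabulate-cong eq) (Vec.tabulate∘lookup v))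

allVecs-cartesian : (k m : ℕ) → allVecs (suc k) m ≡ cartesianProductWith Vec._∷_ (allFin m) (allVecs k m)
allVecs-cartesian k m = go (allFin m)
  where
  go : (is : List (Fin m)) → concatMap (λ i → map (i Vec.∷_) (allVecs k m)) is ≡ cartesianProductWith Vec._∷_ is (allVecs k m)
  go []       = refl
  go (i ∷ is) = cong (map (i Vec.∷_) (allVecs k m) ++_) (go is)

∈-allVecs : (k m : ℕ) (w : Vec (Fin m) k) → w ∈ allVecs k m
∈-allVecs zero    m []      = here refl
∈-allVecs (suc k) m (i ∷ w) = subst ((i ∷ w) ∈_) (sym (allVecs-cartesian k m))
  (∈-cartesianProductWith⁺ Vec._∷_ (∈-allFin i) (∈-allVecs k m w))

allVecs-unique : (k m : ℕ) → Unique (allVecs k m)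
allVecs-unique zero    m = All.[] AllPairs.∷ AllPairs.[]
allVecs-unique (suc k) m = subst Unique (sym (allVecs-cartesian k m))
  (Unique.cartesianProductWith⁺ Vec._∷_ (λ eq → Vec.∷-injective eq) (Unique.allFin⁺ m) (allVecs-unique k m))

Injectiveᵛ : {m k : ℕ} → Vec (Fin m) k → Set
Injectiveᵛ σ = Injective _≡_ _≡_ (lookup σ)

T-isPermᵇ : {m : ℕ} {σ : Vec (Fin m) m} → T (isPermᵇ σ) ⇔ Injectiveᵛ σ
T-isPermᵇ {m} {σ} = mk⇔
  (λ h {i} {j} eq → Equivalence.to T-≡ᵇ-Fin (Equivalence.to T-∨-not (allDistinct.to h i j) (Equivalence.from T-≡ᵇ-Fin eq)))
  (λ inj → allDistinct.from λ i j → Equivalence.from T-∨-not (Equivalence.from T-≡ᵇ-Fin ∘ inj ∘ Equivalence.to T-≡ᵇ-Fin))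
  where
  distinctAt : Fin m → Fin m → Bool
  distinctAt i j = (toℕ i ≡ᵇ toℕ j) ∨ not (toℕ (lookup σ i) ≡ᵇ toℕ (lookup σ j))
  allDistinct : T (isPermᵇ σ) ⇔ (∀ i j → T (distinctAt i j))
  allDistinct = mk⇔ (λ h i → Equivalence.to T-all-allFin (Equivalence.to T-all-allFin h i))
                    (λ h → Equivalence.from T-all-allFin (λ i → Equivalence.from T-all-allFin (h i)))
  module allDistinct = Equivalence allDistinct

Injectiveᵛ-∷ : {m k : ℕ} {x : Fin m} {σ : Vec (Fin m) k} → Injectiveᵛ (x ∷ σ) ⇔ ((∀ i → x ≢ lookup σ i) × Injectiveᵛ σ)
Injectiveᵛ-∷ {x = x} {σ} = mk⇔ uncons cons
  where
  0≢suc : {n : ℕ} {i : Fin n} → Fin.zero ≢ Fin.suc i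
  0≢suc ()
  uncons : Injectiveᵛ (x ∷ σ) → (∀ i → x ≢ lookup σ i) × Injectiveᵛ σ
  uncons inj = (λ i eq → 0≢suc (inj {Fin.zero} {Fin.suc i} eq)) , λ {i} {j} eq → Fin.suc-injective (inj {Fin.suc i} {Fin.suc j} eq)
  cons : (∀ i → x ≢ lookup σ i) × Injectiveᵛ σ → Injectiveᵛ (x ∷ σ)
  cons (x∉ , inj) {Fin.zero}  {Fin.zero}  eq = refl
  cons (x∉ , inj) {Fin.zero}  {Fin.suc j} eq = ⊥-elim (x∉ j eq)
  cons (x∉ , inj) {Fin.suc i} {Fin.zero}  eq = ⊥-elim (x∉ i (sym eq))
  cons (x∉ , inj) {Fin.suc i} {Fin.suc j} eq = cong Fin.suc (inj eq)

module Inverseᵛ {r : ℕ} (τ : Vec (Fin r) r) (inj : Injectiveᵛ τ) where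

  inverse : Fin r → Fin r
  inverse y = proj₁ (injective⇒surjective inj y)

  lookup-inverse : ∀ y → lookup τ (inverse y) ≡ y
  lookup-inverse y = proj₂ (injective⇒surjective inj y)

  inverse-lookup : ∀ x → inverse (lookup τ x) ≡ x
  inverse-lookup x = inj (lookup-inverse (lookup τ x))

_≟ᵛ_ : {r : ℕ} → DecidableEquality (Vec (Fin r) r)
_≟ᵛ_ = Vec.≡-dec Fin._≟_

perms : (m : ℕ) → List (Vec (Fin m) m)
perms m = filterᵇ isPermᵇ (allVecs m m)

perms-unique : (m : ℕ) → Unique (perms m)
perms-unique m = Unique.filter⁺ (T? ∘ isPermᵇ) (allVecs-unique m m)

∈-perms : {m : ℕ} {σ : Vec (Fin m) m} → σ ∈ perms m ⇔ Injectiveᵛ σ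
∈-perms {m} {σ} = mk⇔ (Equivalence.to (T-isPermᵇ {σ = σ}) ∘ proj₂ ∘ ∈-filter⁻ (T? ∘ isPermᵇ) {xs = allVecs m m})
                      (∈-filter⁺ (T? ∘ isPermᵇ) (∈-allVecs m m σ) ∘ Equivalence.from (T-isPermᵇ {σ = σ}))

-- punchOut made total; the value at y ≡ x is junk and never used.
punchOut₀ : {m : ℕ} → Fin (suc (suc m)) → Fin (suc (suc m)) → Fin (suc m)
punchOut₀ x y with x Fin.≟ y
... | yes _   = Fin.zero
... | no  x≢y = Fin.punchOut x≢y

punchOut₀≡punchOut : {m : ℕ} {x y : Fin (suc (suc m))} (x≢y : x ≢ y) → punchOut₀ x y ≡ Fin.punchOut x≢y
punchOut₀≡punchOut {x = x} {y} x≢y with x Fin.≟ y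
... | yes x≡y  = ⊥-elim (x≢y x≡y)
... | no  x≢y′ = Fin.punchOut-cong x refl

count-perms-headed : {m : ℕ} (x : Fin (suc (suc m))) →
  count (λ σ → isPermᵇ (x ∷ σ)) (allVecs (suc m) (suc (suc m))) ≡ count isPermᵇ (allVecs (suc m) (suc m))
count-perms-headed {m} x = count-bijection (allVecs-unique _ _) (allVecs-unique _ _) _ isPermᵇ remove insert
  (λ {σ} _ p → ∈-allVecs _ _ (remove σ) , Equivalence.from (T-isPermᵇ {σ = remove σ}) (remove-injective {σ} (headed p)))
  (λ {τ} _ p → ∈-allVecs _ _ (insert τ) , Equivalence.from (T-isPermᵇ {σ = x ∷ insert τ})
     (Equivalence.from Injectiveᵛ-∷ (insert-fresh τ , insert-injective {τ} (Equivalence.to (T-isPermᵇ {σ = τ}) p))))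
  (λ {σ} _ p → vec-ext λ i → insert-remove σ (proj₁ (headed {σ} p) i))
  (λ {τ} _ _ → vec-ext (remove-insert τ))
  where
  remove : Vec (Fin (suc (suc m))) (suc m) → Vec (Fin (suc m)) (suc m)
  remove = Vec.map (punchOut₀ x)
  insert : Vec (Fin (suc m)) (suc m) → Vec (Fin (suc (suc m))) (suc m)
  insert = Vec.map (Fin.punchIn x)
  headed : {σ : Vec (Fin (suc (suc m))) (suc m)} → T (isPermᵇ (x ∷ σ)) → (∀ i → x ≢ lookup σ i) × Injectiveᵛ σ
  headed {σ} = Equivalence.to Injectiveᵛ-∷ ∘ Equivalence.to (T-isPermᵇ {σ = x ∷ σ})
  lookup-remove : (σ : Vec (Fin (suc (suc m))) (suc m)) {i : Fin (suc m)} (x≢ : x ≢ lookup σ i) →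
                  lookup (remove σ) i ≡ Fin.punchOut x≢
  lookup-remove σ {i} x≢ = trans (Vec.lookup-map i _ σ) (punchOut₀≡punchOut x≢)
  lookup-insert : (τ : Vec (Fin (suc m)) (suc m)) (i : Fin (suc m)) → lookup (insert τ) i ≡ Fin.punchIn x (lookup τ i)
  lookup-insert τ i = Vec.lookup-map i _ τ
  insert-remove : (σ : Vec (Fin (suc (suc m))) (suc m)) {i : Fin (suc m)} (x≢ : x ≢ lookup σ i) →
                  lookup (insert (remove σ)) i ≡ lookup σ i
  insert-remove σ {i} x≢ = trans (lookup-insert (remove σ) i) (trans (cong (Fin.punchIn x) (lookup-remove σ x≢)) (Fin.punchIn-punchOut x≢))
  insert-fresh : (τ : Vec (Fin (suc m)) (suc m)) → ∀ i → x ≢ lookup (insert τ) i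
  insert-fresh τ i eq = Fin.punchInᵢ≢i x (lookup τ i) (sym (trans eq (lookup-insert τ i)))
  remove-insert : (τ : Vec (Fin (suc m)) (suc m)) (i : Fin (suc m)) → lookup (remove (insert τ)) i ≡ lookup τ i
  remove-insert τ i = trans (lookup-remove (insert τ) (insert-fresh τ i))
    (trans (Fin.punchOut-cong x (lookup-insert τ i)) (Fin.punchOut-punchIn x))
  remove-injective : {σ : Vec (Fin (suc (suc m))) (suc m)} → (∀ i → x ≢ lookup σ i) × Injectiveᵛ σ → Injectiveᵛ (remove σ)
  remove-injective {σ} (x∉ , inj) {i} {j} eq =
    inj (Fin.punchOut-injective (x∉ i) (x∉ j) (trans (sym (lookup-remove σ (x∉ i))) (trans eq (lookup-remove σ (x∉ j)))))
  insert-injective : {τ : Vec (Fin (suc m)) (suc m)} → Injectiveᵛ τ → Injectiveᵛ (insert τ)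
  insert-injective {τ} inj {i} {j} eq =
    inj (Fin.punchIn-injective x _ _ (trans (sym (lookup-insert τ i)) (trans eq (lookup-insert τ j))))

length-perms : (m : ℕ) → length (perms m) ≡ m !
length-perms m = trans (length-filterᵇ isPermᵇ (allVecs m m)) (count-perms m)
  where
  count-perms : (m : ℕ) → count isPermᵇ (allVecs m m) ≡ m !
  count-perms zero          = refl
  count-perms (suc zero)    = refl
  count-perms (suc (suc m)) = begin
    count isPermᵇ (allVecs (suc (suc m)) (suc (suc m)))
      ≡⟨ ∑-concatMap _ (λ x → map (x Vec.∷_) (allVecs (suc m) (suc (suc m)))) (allFin (suc (suc m))) ⟩
    ∑ (λ x → count isPermᵇ (map (x Vec.∷_) (allVecs (suc m) (suc (suc m))))) (allFin (suc (suc m)))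
      ≡⟨ ∑-cong (allFin (suc (suc m))) (λ {x} _ → trans (∑-map _ (x Vec.∷_) (allVecs (suc m) (suc (suc m)))) (count-perms-headed x)) ⟩
    ∑ (λ _ → count isPermᵇ (allVecs (suc m) (suc m))) (allFin (suc (suc m)))
      ≡⟨ ∑-const (count isPermᵇ (allVecs (suc m) (suc m))) (allFin (suc (suc m))) ⟩
    length (allFin (suc (suc m))) * count isPermᵇ (allVecs (suc m) (suc m))
      ≡⟨ cong₂ _*_ (length-tabulate {n = suc (suc m)} (λ i → i)) (count-perms (suc m)) ⟩
    suc (suc m) * suc m !
      ∎
    where open ≡-Reasoning

countPerms : (m : ℕ) → (Vec (Fin m) m → Bool) → ℕ
countPerms m P = count P (perms m)

g0≡countPerms : {d : ℕ} (v : Permutation′ d) (m : ℕ) → g0 v m ≡ countPerms m (λ σ → not (containsᵇ σ v))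
g0≡countPerms v m = trans (length-filterᵇ _ (allVecs m m)) (sym (count-filterᵇ isPermᵇ _ (allVecs m m)))

countPerms-true : (m : ℕ) → countPerms m (λ _ → true) ≡ m !
countPerms-true m = trans (count-true (perms m)) (length-perms m)

countPerms-cong : {m : ℕ} {P Q : Vec (Fin m) m → Bool} → (∀ {σ} → Injectiveᵛ σ → P σ ≡ Q σ) →
                  countPerms m P ≡ countPerms m Q
countPerms-cong {m} eq = count-cong (perms m) (eq ∘ Equivalence.to ∈-perms)

countPerms-mono : {m : ℕ} {P Q : Vec (Fin m) m → Bool} → (∀ {σ} → Injectiveᵛ σ → T (P σ) → T (Q σ)) →
                  countPerms m P ≤ countPerms m Q
countPerms-mono {m} imp = count-mono (perms m) (imp ∘ Equivalence.to ∈-perms)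

-- Probabilities on S_m

frac : ℕ → (b : ℕ) → .{{NonZero b}} → ℚ
frac a b = ℤ.+ a / b

private
  toℚᵘ-frac : (a b : ℕ) .{{_ : NonZero b}} → ℚ.toℚᵘ (frac a b) ℚᵘ.≃ mkℚᵘ (ℤ.+ a) (pred b)
  toℚᵘ-frac a (suc b) = ℚ.toℚᵘ-fromℚᵘ (mkℚᵘ (ℤ.+ a) b)

  via-ℚᵘ : {p q : ℚ} (p′ q′ : ℚᵘ) → ℚ.toℚᵘ p ℚᵘ.≃ p′ → ℚ.toℚᵘ q ℚᵘ.≃ q′ → p′ ℚᵘ.≃ q′ → p ≡ q
  via-ℚᵘ p′ q′ p≃p′ q≃q′ p′≃q′ = ℚ.toℚᵘ-injective (ℚᵘ.≃-trans p≃p′ (ℚᵘ.≃-trans p′≃q′ (ℚᵘ.≃-sym q≃q′)))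

frac-cong : (a b c d : ℕ) .{{_ : NonZero b}} .{{_ : NonZero d}} → a * d ≡ c * b → frac a b ≡ frac c d
frac-cong a (suc b) c (suc d) eq = via-ℚᵘ _ _ (toℚᵘ-frac a (suc b)) (toℚᵘ-frac c (suc d))
  (*≡* (trans (sym (ℤ.pos-* a (suc d))) (trans (cong ℤ.+_ eq) (ℤ.pos-* c (suc b)))))

frac-+ : (a c b : ℕ) .{{_ : NonZero b}} → frac a b ℚ.+ frac c b ≡ frac (a + c) b
frac-+ a c (suc b) = via-ℚᵘ (mkℚᵘ (ℤ.+ a) b ℚᵘ.+ mkℚᵘ (ℤ.+ c) b) _
  (ℚᵘ.≃-trans (ℚ.toℚᵘ-homo-+ (frac a (suc b)) (frac c (suc b))) (ℚᵘ.+-cong (toℚᵘ-frac a (suc b)) (toℚᵘ-frac c (suc b))))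
  (toℚᵘ-frac (a + c) (suc b))
  (*≡* (begin
    (ℤ.+ a ℤ.* ℤ.+ b₁ ℤ.+ ℤ.+ c ℤ.* ℤ.+ b₁) ℤ.* ℤ.+ b₁  ≡⟨ cong (ℤ._* ℤ.+ b₁) (cong₂ ℤ._+_ (ℤ.pos-* a b₁) (ℤ.pos-* c b₁)) ⟨
    (ℤ.+ (a * b₁) ℤ.+ ℤ.+ (c * b₁)) ℤ.* ℤ.+ b₁        ≡⟨ cong (ℤ._* ℤ.+ b₁) (ℤ.pos-+ (a * b₁) (c * b₁)) ⟨
    ℤ.+ (a * b₁ + c * b₁) ℤ.* ℤ.+ b₁                  ≡⟨ ℤ.pos-* (a * b₁ + c * b₁) b₁ ⟨
    ℤ.+ ((a * b₁ + c * b₁) * b₁)                      ≡⟨ cong ℤ.+_ (trans (cong (_* b₁) (sym (*-distribʳ-+ b₁ a c))) (*-assoc (a + c) b₁ b₁)) ⟩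
    ℤ.+ ((a + c) * (b₁ * b₁))                        ≡⟨ ℤ.pos-* (a + c) (b₁ * b₁) ⟩
    ℤ.+ (a + c) ℤ.* ℤ.+ (b₁ * b₁)                    ∎))
  where
  open ≡-Reasoning
  b₁ = suc b

frac-* : (a b c d : ℕ) .{{_ : NonZero b}} .{{_ : NonZero d}} → frac a b ℚ.* frac c d ≡ (frac (a * c) (b * d)) {{m*n≢0 b d}}
frac-* a (suc b) c (suc d) = via-ℚᵘ (mkℚᵘ (ℤ.+ a) b ℚᵘ.* mkℚᵘ (ℤ.+ c) d) _
  (ℚᵘ.≃-trans (ℚ.toℚᵘ-homo-* (frac a (suc b)) (frac c (suc d))) (ℚᵘ.*-cong (toℚᵘ-frac a (suc b)) (toℚᵘ-frac c (suc d))))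
  (toℚᵘ-frac (a * c) (suc b * suc d) {{m*n≢0 (suc b) (suc d)}})
  (*≡* (cong (ℤ._* ℤ.+ (suc b * suc d)) (sym (ℤ.pos-* a c))))

frac-mono-≤ : (a b c d : ℕ) .{{_ : NonZero b}} .{{_ : NonZero d}} → a * d ≤ c * b → frac a b ℚ.≤ frac c d
frac-mono-≤ a (suc b) c (suc d) le = ℚ.toℚᵘ-cancel-≤ (ℚᵘ.≤-respˡ-≃ (ℚᵘ.≃-sym (toℚᵘ-frac a (suc b)))
  (ℚᵘ.≤-respʳ-≃ (ℚᵘ.≃-sym (toℚᵘ-frac c (suc d)))
    (*≤* (subst₂ ℤ._≤_ (ℤ.pos-* a (suc d)) (ℤ.pos-* c (suc b)) (ℤ.+≤+ le)))))

frac-nonNegative : (a b : ℕ) .{{_ : NonZero b}} → 0ℚ ℚ.≤ frac a b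
frac-nonNegative a b = frac-mono-≤ 0 1 a b z≤n

ℙ : (m : ℕ) → (Vec (Fin m) m → Bool) → ℚ
ℙ m P = frac (countPerms m P) (m !) {{m !≢0}}

ℙ-cong : {m : ℕ} {P Q : Vec (Fin m) m → Bool} → (∀ {σ} → Injectiveᵛ σ → P σ ≡ Q σ) → ℙ m P ≡ ℙ m Q
ℙ-cong {m} eq = cong (λ c → frac c (m !) {{m !≢0}}) (countPerms-cong eq)

ℙ-split : {m : ℕ} (P X : Vec (Fin m) m → Bool) → ℙ m P ≡ ℙ m (λ σ → P σ ∧ X σ) ℚ.+ ℙ m (λ σ → P σ ∧ not (X σ))
ℙ-split {m} P X = trans (cong (λ c → frac c (m !) {{m !≢0}}) (count-∧-not P X (perms m)))
  (sym (frac-+ (countPerms m (λ σ → P σ ∧ X σ)) (countPerms m (λ σ → P σ ∧ not (X σ))) (m !) {{m !≢0}}))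

ℙ-true : (m : ℕ) → ℙ m (λ _ → true) ≡ 1ℚ
ℙ-true m = frac-cong (countPerms m (λ _ → true)) (m !) 1 1 {{m !≢0}}
  (trans (*-identityʳ _) (trans (countPerms-true m) (sym (*-identityˡ (m !)))))

ℙ-difference : {m : ℕ} {P Q : Vec (Fin m) m → Bool} → countPerms m P ≤ countPerms m Q →
               ℙ m Q ℚ.- ℙ m P ≡ frac (countPerms m Q ∸ countPerms m P) (m !) {{m !≢0}}
ℙ-difference {m} {P} {Q} P≤Q = begin
  ℙ m Q ℚ.- ℙ m P                   ≡⟨ cong (ℚ._- ℙ m P) (trans (cong (λ c → frac c (m !) {{m !≢0}}) (sym (m+[n∸m]≡n P≤Q)))
                                                         (sym (frac-+ (countPerms m P) _ (m !) {{m !≢0}}))) ⟩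
  (ℙ m P ℚ.+ difference) ℚ.- ℙ m P  ≡⟨ solve 2 (λ p x → (p :+ x) :- p := x) refl (ℙ m P) difference ⟩
  difference                        ∎
  where
  open ≡-Reasoning
  open ℚ-Solver
  difference = frac (countPerms m Q ∸ countPerms m P) (m !) {{m !≢0}}

-- Standardisation of a block

-- The local go of nth cannot be named; nthᴸ σ is a metavariable that Agda solves to it.
private
  mutual
    nthᴸ : {m : ℕ} → Vec (Fin m) m → List (Fin m) → ℕ → ℕ
    nthᴸ σ = _

    nth-unfold : {m : ℕ} (σ : Vec (Fin m) m) (i : ℕ) → nth σ i ≡ nthᴸ σ (Vec.toList σ) i
    nth-unfold σ i with Vec.toList σ
    ... | _ = refl

  nthᴸ-lookup : {m k : ℕ} (σ : Vec (Fin m) m) (τ : Vec (Fin m) k) (p : Fin k) → nthᴸ σ (Vec.toList τ) (toℕ p) ≡ toℕ (lookup τ p)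
  nthᴸ-lookup σ (x ∷ τ) Fin.zero    = refl
  nthᴸ-lookup σ (x ∷ τ) (Fin.suc p) = nthᴸ-lookup σ τ p

nth-lookup : {m : ℕ} (σ : Vec (Fin m) m) (p : Fin m) → nth σ (toℕ p) ≡ toℕ (lookup σ p)
nth-lookup σ p = trans (nth-unfold σ (toℕ p)) (nthᴸ-lookup σ σ p)

nth-lookup-fromℕ< : {m i : ℕ} (σ : Vec (Fin m) m) (i<m : i < m) → nth σ i ≡ toℕ (lookup σ (Fin.fromℕ< i<m))
nth-lookup-fromℕ< σ i<m = trans (cong (nth σ) (sym (Fin.toℕ-fromℕ< i<m))) (nth-lookup σ (Fin.fromℕ< i<m))

window : {m : ℕ} → Vec (Fin m) m → ℕ → ℕ → ℕ
window σ s i = nth σ (s + i)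

InjectiveOn : (ℕ → ℕ) → ℕ → Set
InjectiveOn w r = ∀ {a b} → a < r → b < r → w a ≡ w b → a ≡ b

nth-injectiveOn : {m : ℕ} {σ : Vec (Fin m) m} → Injectiveᵛ σ → (s r : ℕ) → s + r ≤ m → InjectiveOn (window σ s) r
nth-injectiveOn {σ = σ} inj s r s+r≤m {a} {b} a<r b<r eq = +-cancelˡ-≡ s a b (begin
  s + a                                        ≡⟨ Fin.toℕ-fromℕ< (in-range a<r) ⟨
  toℕ (Fin.fromℕ< (in-range a<r))              ≡⟨ cong toℕ (inj (Fin.toℕ-injective (begin
      toℕ (lookup σ (Fin.fromℕ< (in-range a<r)))  ≡⟨ nth-lookup-fromℕ< σ (in-range a<r) ⟨
      nth σ (s + a)                                ≡⟨ eq ⟩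
      nth σ (s + b)                                ≡⟨ nth-lookup-fromℕ< σ (in-range b<r) ⟩
      toℕ (lookup σ (Fin.fromℕ< (in-range b<r)))  ∎))) ⟩
  toℕ (Fin.fromℕ< (in-range b<r))              ≡⟨ Fin.toℕ-fromℕ< (in-range b<r) ⟩
  s + b                                        ∎)
  where
  open ≡-Reasoning
  in-range : ∀ {i} → i < r → s + i < _
  in-range i<r = <-≤-trans (+-monoʳ-< s i<r) s+r≤m

rank : (ℕ → ℕ) → ℕ → ℕ → ℕ
rank w r p = count (λ q → w q <ᵇ w p) (upTo r)

rank< : (w : ℕ → ℕ) {r p : ℕ} → p < r → rank w r p < r
rank< w {r} {p} p<r = subst (rank w r p <_) (trans (count-true (upTo r)) (length-upTo r))
  (count-mono-< (λ _ _ → tt) (∈-upTo⁺ p<r) (λ t → n≮n (w p) (<ᵇ⇒< (w p) (w p) t)) tt)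

rank-mono-< : (w : ℕ → ℕ) {r a b : ℕ} → a < r → w a < w b → rank w r a < rank w r b
rank-mono-< w a<r wa<wb = count-mono-< (λ {q} _ t → <⇒<ᵇ (<-trans (<ᵇ⇒< (w q) _ t) wa<wb)) (∈-upTo⁺ a<r)
  (λ t → n≮n _ (<ᵇ⇒< (w _) (w _) t)) (<⇒<ᵇ wa<wb)

rank-cancel-< : {w : ℕ → ℕ} {r a b : ℕ} → InjectiveOn w r → a < r → b < r → rank w r a < rank w r b → w a < w b
rank-cancel-< {w} inj a<r b<r lt with <-cmp (w _) (w _)
... | tri< wa<wb _ _ = wa<wb
... | tri≈ _ wa≡wb _ with refl ← inj a<r b<r wa≡wb = ⊥-elim (n≮n _ lt)
... | tri> _ _ wb<wa = ⊥-elim (<-asym lt (rank-mono-< w b<r wb<wa))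

rank-injective : {w : ℕ → ℕ} {r a b : ℕ} → InjectiveOn w r → a < r → b < r → rank w r a ≡ rank w r b → a ≡ b
rank-injective {w} inj a<r b<r eq with <-cmp (w _) (w _)
... | tri< wa<wb _ _ = ⊥-elim (<-irrefl eq (rank-mono-< w a<r wa<wb))
... | tri≈ _ wa≡wb _ = inj a<r b<r wa≡wb
... | tri> _ _ wb<wa = ⊥-elim (<-irrefl (sym eq) (rank-mono-< w b<r wb<wa))

rank-allFin : (w : ℕ → ℕ) (r a : ℕ) → rank w r a ≡ count (λ q → w (toℕ q) <ᵇ w a) (allFin r)
rank-allFin w r a = trans (cong (count (λ q → w q <ᵇ w a)) (sym (map-toℕ-allFin r))) (∑-map _ toℕ (allFin r))

rank-lookup : {r : ℕ} {τ : Vec (Fin r) r} → Injectiveᵛ τ → (p : Fin r) → rank (window τ 0) r (toℕ p) ≡ toℕ (lookup τ p)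
rank-lookup {r} {τ} inj p = begin
  rank (window τ 0) r (toℕ p)                                         ≡⟨ rank-allFin (window τ 0) r (toℕ p) ⟩
  count (λ q → nth τ (toℕ q) <ᵇ nth τ (toℕ p)) (allFin r)              ≡⟨ count-cong (allFin r) (λ {q} _ → cong₂ _<ᵇ_ (nth-lookup τ q) (nth-lookup τ p)) ⟩
  count ((λ y → toℕ y <ᵇ toℕ (lookup τ p)) ∘ lookup τ) (allFin r)     ≡⟨ count-∘-injective (λ y → toℕ y <ᵇ toℕ (lookup τ p)) inj ⟩
  count (λ y → toℕ y <ᵇ toℕ (lookup τ p)) (allFin r)                  ≡⟨ count-<-allFin (lookup τ p) ⟩
  toℕ (lookup τ p)                                                    ∎
  where open ≡-Reasoning

-- The permutation of {0, …, r − 1} order-isomorphic to σ_s ⋯ σ_{s+r−1} (positions from 0).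
std : {m : ℕ} (s r : ℕ) → Vec (Fin m) m → Vec (Fin r) r
std s r σ = Vec.tabulate (λ p → Fin.fromℕ< (rank< (window σ s) (Fin.toℕ<n p)))

toℕ-lookup-std : {m r : ℕ} (s : ℕ) (σ : Vec (Fin m) m) (p : Fin r) → toℕ (lookup (std s r σ) p) ≡ rank (window σ s) r (toℕ p)
toℕ-lookup-std s σ p = trans (cong toℕ (Vec.lookup∘tabulate _ p)) (Fin.toℕ-fromℕ< _)

nth-std : {m r a : ℕ} (s : ℕ) (σ : Vec (Fin m) m) → a < r → nth (std s r σ) a ≡ rank (window σ s) r a
nth-std {r = r} s σ a<r = trans (nth-lookup-fromℕ< (std s r σ) a<r)
  (trans (toℕ-lookup-std s σ (Fin.fromℕ< a<r)) (cong (rank (window σ s) r) (Fin.toℕ-fromℕ< a<r)))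

std-injective : {m r : ℕ} (s : ℕ) (σ : Vec (Fin m) m) → InjectiveOn (window σ s) r → Injectiveᵛ (std s r σ)
std-injective s σ inj {i} {j} eq = Fin.toℕ-injective (rank-injective inj (Fin.toℕ<n i) (Fin.toℕ<n j)
  (trans (sym (toℕ-lookup-std s σ i)) (trans (cong toℕ eq) (toℕ-lookup-std s σ j))))

std-<ᵇ : {m r a b : ℕ} (s : ℕ) (σ : Vec (Fin m) m) → InjectiveOn (window σ s) r → a < r → b < r →
         (nth (std s r σ) a <ᵇ nth (std s r σ) b) ≡ (window σ s a <ᵇ window σ s b)
std-<ᵇ s σ inj a<r b<r rewrite nth-std s σ a<r | nth-std s σ b<r =
  <ᵇ-cong (mk⇔ (rank-cancel-< inj a<r b<r) (rank-mono-< (window σ s) a<r))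

std-of-injective : {r : ℕ} {τ : Vec (Fin r) r} → Injectiveᵛ τ → std 0 r τ ≡ τ
std-of-injective {τ = τ} inj = vec-ext λ p → Fin.toℕ-injective (trans (toℕ-lookup-std 0 τ p) (rank-lookup {τ = τ} inj p))

std-cong : {m m′ r : ℕ} (s s′ : ℕ) (σ : Vec (Fin m) m) (σ′ : Vec (Fin m′) m′) →
           (∀ {a b} → a < r → b < r → (window σ s a <ᵇ window σ s b) ≡ (window σ′ s′ a <ᵇ window σ′ s′ b)) →
           std s r σ ≡ std s′ r σ′
std-cong {r = r} s s′ σ σ′ same = vec-ext λ p → Fin.toℕ-injective (begin
  toℕ (lookup (std s r σ) p)      ≡⟨ toℕ-lookup-std s σ p ⟩
  rank (window σ s) r (toℕ p)     ≡⟨ count-cong (upTo r) (λ q∈ → same (∈-upTo⁻ q∈) (Fin.toℕ<n p)) ⟩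
  rank (window σ′ s′) r (toℕ p)   ≡⟨ toℕ-lookup-std s′ σ′ p ⟨
  toℕ (lookup (std s′ r σ′) p)    ∎)
  where open ≡-Reasoning

extend : {r : ℕ} → (Fin r → Fin r) → ℕ → ℕ
extend {r} π a with a <? r
... | yes a<r = toℕ (π (Fin.fromℕ< a<r))
... | no  _   = a

extend-< : {r : ℕ} (π : Fin r → Fin r) {a : ℕ} (a<r : a < r) → extend π a ≡ toℕ (π (Fin.fromℕ< a<r))
extend-< {r} π {a} a<r with a <? r
... | yes _   = cong (toℕ ∘ π) (Fin.fromℕ<-cong a a refl _ _)
... | no  a≮r = ⊥-elim (a≮r a<r)

extend-≮ : {r : ℕ} (π : Fin r → Fin r) {a : ℕ} → ¬ a < r → extend π a ≡ a
extend-≮ {r} π {a} a≮r with a <? r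
... | yes a<r = ⊥-elim (a≮r a<r)
... | no  _   = refl

extend-toℕ : {r : ℕ} (π : Fin r → Fin r) (q : Fin r) → extend π (toℕ q) ≡ toℕ (π q)
extend-toℕ π q = trans (extend-< π (Fin.toℕ<n q)) (cong (toℕ ∘ π) (Fin.fromℕ<-toℕ q _))

extend-inverse : {r : ℕ} {π π′ : Fin r → Fin r} → (∀ x → π (π′ x) ≡ x) → ∀ a → extend π (extend π′ a) ≡ a
extend-inverse {r} {π} {π′} ππ′ a with a <? r
... | yes a<r = trans (extend-toℕ π _) (trans (cong toℕ (ππ′ _)) (Fin.toℕ-fromℕ< a<r))
... | no  a≮r = extend-≮ π a≮r

extend-bounded : {r : ℕ} (π : Fin r → Fin r) {a : ℕ} → a < r → extend π a < r
extend-bounded π a<r = subst (_< _) (sym (extend-< π a<r)) (Fin.toℕ<n _)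

blockMap : {r : ℕ} → ℕ → (Fin r → Fin r) → ℕ → ℕ
blockMap s π i with i <? s
... | yes _ = i
... | no  _ = s + extend π (i ∸ s)

blockMap-< : {r : ℕ} (s : ℕ) (π : Fin r → Fin r) {i : ℕ} → i < s → blockMap s π i ≡ i
blockMap-< s π {i} i<s with i <? s
... | yes _   = refl
... | no  i≮s = ⊥-elim (i≮s i<s)

blockMap-+ : {r : ℕ} (s : ℕ) (π : Fin r → Fin r) (a : ℕ) → blockMap s π (s + a) ≡ s + extend π a
blockMap-+ s π a with s + a <? s
... | yes s+a<s = ⊥-elim (m+n≮m s a s+a<s)
... | no  _     = cong (λ i → s + extend π i) (m+n∸m≡n s a)

blockMap-inverse : {r : ℕ} (s : ℕ) {π π′ : Fin r → Fin r} → (∀ x → π (π′ x) ≡ x) → ∀ i → blockMap s π (blockMap s π′ i) ≡ i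
blockMap-inverse s {π} {π′} ππ′ i with i <? s
... | yes i<s = blockMap-< s π i<s
... | no  i≮s = trans (blockMap-+ s π _) (trans (cong (s +_) (extend-inverse ππ′ (i ∸ s))) (m+[n∸m]≡n (≮⇒≥ i≮s)))

blockMap-bounded : {r m : ℕ} (s : ℕ) (π : Fin r → Fin r) → s + r ≤ m → ∀ {i} → i < m → blockMap s π i < m
blockMap-bounded {r} s π s+r≤m {i} i<m with i <? s
... | yes _   = i<m
... | no  i≮s = case (i ∸ s) <? r of λ where
  (yes in-block) → <-≤-trans (+-monoʳ-< s (extend-bounded π in-block)) s+r≤m
  (no  beyond)   → subst (_< _) (sym (trans (cong (s +_) (extend-≮ π beyond)) (m+[n∸m]≡n (≮⇒≥ i≮s)))) i<m

liftℕ : {m : ℕ} (f : ℕ → ℕ) → (∀ {i} → i < m → f i < m) → Fin m → Fin m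
liftℕ f bounded i = Fin.fromℕ< (bounded (Fin.toℕ<n i))

reindex : {m : ℕ} → (Fin m → Fin m) → Vec (Fin m) m → Vec (Fin m) m
reindex ρ σ = Vec.tabulate (lookup σ ∘ ρ)

nth-reindex-liftℕ : {m i : ℕ} (f : ℕ → ℕ) (bounded : ∀ {i} → i < m → f i < m) (σ : Vec (Fin m) m) →
                    i < m → nth (reindex (liftℕ f bounded) σ) i ≡ nth σ (f i)
nth-reindex-liftℕ {i = i} f bounded σ i<m = begin
  nth (reindex (liftℕ f bounded) σ) i                             ≡⟨ nth-lookup-fromℕ< (reindex (liftℕ f bounded) σ) i<m ⟩
  toℕ (lookup (reindex (liftℕ f bounded) σ) (Fin.fromℕ< i<m))     ≡⟨ cong toℕ (Vec.lookup∘tabulate _ (Fin.fromℕ< i<m)) ⟩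
  toℕ (lookup σ (liftℕ f bounded (Fin.fromℕ< i<m)))               ≡⟨ nth-lookup σ _ ⟨
  nth σ (toℕ (Fin.fromℕ< (bounded (Fin.toℕ<n (Fin.fromℕ< i<m))))) ≡⟨ cong (nth σ) (Fin.toℕ-fromℕ< _) ⟩
  nth σ (f (toℕ (Fin.fromℕ< i<m)))                                ≡⟨ cong (nth σ ∘ f) (Fin.toℕ-fromℕ< i<m) ⟩
  nth σ (f i)                                                     ∎
  where open ≡-Reasoning

reindex-inverse : {m : ℕ} {ρ ρ′ : Fin m → Fin m} → (∀ i → ρ′ (ρ i) ≡ i) → (σ : Vec (Fin m) m) → reindex ρ (reindex ρ′ σ) ≡ σ
reindex-inverse {ρ = ρ} ρ′ρ σ = vec-ext λ i →
  trans (Vec.lookup∘tabulate _ i) (trans (Vec.lookup∘tabulate _ (ρ i)) (cong (lookup σ) (ρ′ρ i)))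

reindex-injective : {m : ℕ} {ρ ρ′ : Fin m → Fin m} → (∀ i → ρ′ (ρ i) ≡ i) → {σ : Vec (Fin m) m} →
                    Injectiveᵛ σ → Injectiveᵛ (reindex ρ σ)
reindex-injective {ρ = ρ} {ρ′} ρ′ρ {σ} inj {i} {j} eq =
  trans (sym (ρ′ρ i)) (trans (cong ρ′ (inj (trans (sym (Vec.lookup∘tabulate _ i)) (trans eq (Vec.lookup∘tabulate _ j))))) (ρ′ρ j))

module _ {m r : ℕ} (s : ℕ) (s+r≤m : s + r ≤ m) where

  blockPositions : (Fin r → Fin r) → Fin m → Fin m
  blockPositions π = liftℕ (blockMap s π) (blockMap-bounded s π s+r≤m)

  blockPositions-inverse : {π π′ : Fin r → Fin r} → (∀ x → π (π′ x) ≡ x) → ∀ i → blockPositions π (blockPositions π′ i) ≡ i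
  blockPositions-inverse {π} ππ′ i = Fin.toℕ-injective
    (trans (Fin.toℕ-fromℕ< _) (trans (cong (blockMap s π) (Fin.toℕ-fromℕ< _)) (blockMap-inverse s ππ′ (toℕ i))))

  permuteBlock : (Fin r → Fin r) → Vec (Fin m) m → Vec (Fin m) m
  permuteBlock π = reindex (blockPositions π)

  permuteBlock-inverse : {π π′ : Fin r → Fin r} → (∀ x → π (π′ x) ≡ x) → (σ : Vec (Fin m) m) →
                         permuteBlock π′ (permuteBlock π σ) ≡ σ
  permuteBlock-inverse {π} {π′} ππ′ = reindex-inverse {ρ = blockPositions π′} {ρ′ = blockPositions π} (blockPositions-inverse ππ′)

  permuteBlock-injective : {π π′ : Fin r → Fin r} → (∀ x → π (π′ x) ≡ x) → {σ : Vec (Fin m) m} →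
                           Injectiveᵛ σ → Injectiveᵛ (permuteBlock π′ σ)
  permuteBlock-injective {π} {π′} ππ′ {σ} =
    reindex-injective {ρ = blockPositions π′} {ρ′ = blockPositions π} (blockPositions-inverse ππ′) {σ}

  nth-permuteBlock-< : (π : Fin r → Fin r) (σ : Vec (Fin m) m) {i : ℕ} → i < s → nth (permuteBlock π σ) i ≡ nth σ i
  nth-permuteBlock-< π σ i<s =
    trans (nth-reindex-liftℕ (blockMap s π) (blockMap-bounded s π s+r≤m) σ (<-≤-trans i<s (≤-trans (m≤m+n s r) s+r≤m)))
          (cong (nth σ) (blockMap-< s π i<s))

  window-permuteBlock : (π : Fin r → Fin r) (σ : Vec (Fin m) m) (q : Fin r) →
                        window (permuteBlock π σ) s (toℕ q) ≡ window σ s (toℕ (π q))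
  window-permuteBlock π σ q =
    trans (nth-reindex-liftℕ (blockMap s π) (blockMap-bounded s π s+r≤m) σ (<-≤-trans (+-monoʳ-< s (Fin.toℕ<n q)) s+r≤m))
          (cong (nth σ) (trans (blockMap-+ s π (toℕ q)) (cong (s +_) (extend-toℕ π q))))

  lookup-std-permuteBlock : {π π′ : Fin r → Fin r} → (∀ x → π′ (π x) ≡ x) → (σ : Vec (Fin m) m) (p : Fin r) →
                            lookup (std s r (permuteBlock π σ)) p ≡ lookup (std s r σ) (π p)
  lookup-std-permuteBlock {π} {π′} π′π σ p = Fin.toℕ-injective (begin
    toℕ (lookup (std s r σπ) p)                                        ≡⟨ toℕ-lookup-std s σπ p ⟩
    rank (window σπ s) r (toℕ p)                                       ≡⟨ rank-allFin (window σπ s) r (toℕ p) ⟩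
    count (λ q → window σπ s (toℕ q) <ᵇ window σπ s (toℕ p)) (allFin r) ≡⟨ count-cong (allFin r) (λ {q} _ →
                                                                            cong₂ _<ᵇ_ (window-permuteBlock π σ q) (window-permuteBlock π σ p)) ⟩
    count (w∘π ∘ π) (allFin r)                                          ≡⟨ count-∘-injective w∘π (λ eq → trans (sym (π′π _)) (trans (cong π′ eq) (π′π _))) ⟩
    count w∘π (allFin r)                                                ≡⟨ rank-allFin (window σ s) r (toℕ (π p)) ⟨
    rank (window σ s) r (toℕ (π p))                                     ≡⟨ toℕ-lookup-std s σ (π p) ⟨
    toℕ (lookup (std s r σ) (π p))                                      ∎)
    where
    open ≡-Reasoning
    σπ = permuteBlock π σ
    w∘π : Fin r → Bool
    w∘π q = window σ s (toℕ q) <ᵇ window σ s (toℕ (π p))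

-- Sorting σ by its standardised block τ, all fibres have the same size: permuting the block
-- by τ⁻¹ ∘ τ′ moves the fibre of τ bijectively onto that of τ′ and leaves the prefix, hence Q, alone.
module _ {m r : ℕ} (s : ℕ) (s+r≤m : s + r ≤ m) (Q : Vec (Fin m) m → Bool)
         (Q-local : ∀ {σ σ′} → (∀ {i} → i < s → nth σ i ≡ nth σ′ i) → Q σ ≡ Q σ′) where

  private
    fibre : Vec (Fin r) r → ℕ
    fibre τ = countPerms m (λ σ → Q σ ∧ isYes (std s r σ ≟ᵛ τ))

    permuteBlock-fibre : {τ τ′ : Vec (Fin r) r} {π π′ : Fin r → Fin r} → (∀ x → π′ (π x) ≡ x) →
      (∀ x → lookup τ (π x) ≡ lookup τ′ x) → {σ : Vec (Fin m) m} → σ ∈ perms m → T (Q σ ∧ isYes (std s r σ ≟ᵛ τ)) →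
      permuteBlock s s+r≤m π σ ∈ perms m × T (Q (permuteBlock s s+r≤m π σ) ∧ isYes (std s r (permuteBlock s s+r≤m π σ) ≟ᵛ τ′))
    permuteBlock-fibre {τ} {τ′} {π} {π′} π′π τπ≡τ′ {σ} σ∈ Qσ∧std≡τ =
      Equivalence.from ∈-perms (permuteBlock-injective s s+r≤m {π = π′} {π′ = π} π′π {σ} (Equivalence.to ∈-perms σ∈)) ,
      Equivalence.from T-∧ (subst T (Q-local (sym ∘ nth-permuteBlock-< s s+r≤m π σ)) Qσ ,
                            fromWitness (vec-ext λ p → trans (lookup-std-permuteBlock s s+r≤m {π′ = π′} π′π σ p)
                              (trans (cong (λ v → lookup v (π p)) (toWitness std≡τ)) (τπ≡τ′ p))))
      where
      Qσ = proj₁ (Equivalence.to T-∧ Qσ∧std≡τ)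
      std≡τ = proj₂ (Equivalence.to (T-∧ {Q σ}) Qσ∧std≡τ)

    fibre-constant : {τ τ′ : Vec (Fin r) r} → Injectiveᵛ τ → Injectiveᵛ τ′ → fibre τ ≡ fibre τ′
    fibre-constant {τ} {τ′} inj inj′ = count-bijection (perms-unique m) (perms-unique m) _ _
      (permuteBlock s s+r≤m π) (permuteBlock s s+r≤m π′)
      (permuteBlock-fibre {π′ = π′} π′π (Iτ.lookup-inverse ∘ lookup τ′))
      (permuteBlock-fibre {π′ = π} ππ′ (Iτ′.lookup-inverse ∘ lookup τ))
      (λ {σ} _ _ → permuteBlock-inverse s s+r≤m ππ′ σ)
      (λ {σ} _ _ → permuteBlock-inverse s s+r≤m π′π σ)
      where
      module Iτ  = Inverseᵛ τ inj
      module Iτ′ = Inverseᵛ τ′ inj′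
      π π′ : Fin r → Fin r
      π  = Iτ.inverse ∘ lookup τ′
      π′ = Iτ′.inverse ∘ lookup τ
      ππ′ : ∀ x → π (π′ x) ≡ x
      ππ′ x = trans (cong Iτ.inverse (Iτ′.lookup-inverse (lookup τ x))) (Iτ.inverse-lookup x)
      π′π : ∀ x → π′ (π x) ≡ x
      π′π x = trans (cong Iτ′.inverse (Iτ.lookup-inverse (lookup τ′ x))) (Iτ′.inverse-lookup x)

    id-injective : Injectiveᵛ (Vec.allFin r)
    id-injective {i} {j} eq = trans (sym (Vec.lookup-allFin i)) (trans eq (Vec.lookup-allFin j))

    std-fibre : (R : Vec (Fin r) r → Bool) (σ : Vec (Fin m) m) (τ : Vec (Fin r) r) →
                (Q σ ∧ R (std s r σ)) ∧ isYes (std s r σ ≟ᵛ τ) ≡ R τ ∧ (Q σ ∧ isYes (std s r σ ≟ᵛ τ))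
    std-fibre R σ τ with std s r σ ≟ᵛ τ
    ... | yes refl = trans (∧-identityʳ _) (trans (∧-comm (Q σ) _) (cong (R τ ∧_) (sym (∧-identityʳ (Q σ)))))
    ... | no  _    = trans (∧-zeroʳ _) (sym (trans (cong (R τ ∧_) (∧-zeroʳ (Q σ))) (∧-zeroʳ (R τ))))

    countPerms-by-fibres : (R : Vec (Fin r) r → Bool) →
                           countPerms m (λ σ → Q σ ∧ R (std s r σ)) ≡ count R (perms r) * fibre (Vec.allFin r)
    countPerms-by-fibres R = begin
      countPerms m (λ σ → Q σ ∧ R (std s r σ))
        ≡⟨ count-fibres _≟ᵛ_ (std s r) _ (perms m) (perms-unique r) (λ {σ} σ∈ _ → Equivalence.from ∈-perms
             (std-injective s σ (nth-injectiveOn {σ = σ} (Equivalence.to ∈-perms σ∈) s r s+r≤m))) ⟩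
      ∑ (λ τ → count (λ σ → (Q σ ∧ R (std s r σ)) ∧ isYes (std s r σ ≟ᵛ τ)) (perms m)) (perms r)
        ≡⟨ ∑-cong (perms r) (λ {τ} _ → trans (count-cong (perms m) (λ {σ} _ → std-fibre R σ τ)) (count-const-∧ (R τ) _ (perms m))) ⟩
      ∑ (λ τ → boolToℕ (R τ) * fibre τ) (perms r)
        ≡⟨ ∑-cong (perms r) (λ τ∈ → cong (boolToℕ (R _) *_) (fibre-constant (Equivalence.to ∈-perms τ∈) id-injective)) ⟩
      ∑ (λ τ → boolToℕ (R τ) * fibre (Vec.allFin r)) (perms r)
        ≡⟨ ∑-*ʳ (boolToℕ ∘ R) _ (perms r) ⟩
      count R (perms r) * fibre (Vec.allFin r)
        ∎
      where open ≡-Reasoning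

  countPerms-block-independent : (R : Vec (Fin r) r → Bool) →
                                 countPerms m (λ σ → Q σ ∧ R (std s r σ)) * r ! ≡ countPerms m Q * countPerms r R
  countPerms-block-independent R = begin
    countPerms m (λ σ → Q σ ∧ R (std s r σ)) * r !   ≡⟨ cong (_* r !) (countPerms-by-fibres R) ⟩
    countPerms r R * f * r !                         ≡⟨ *-comm (countPerms r R * f) (r !) ⟩
    r ! * (countPerms r R * f)                       ≡⟨ cong (r ! *_) (*-comm (countPerms r R) f) ⟩
    r ! * (f * countPerms r R)                       ≡⟨ *-assoc (r !) f (countPerms r R) ⟨
    r ! * f * countPerms r R                         ≡⟨ cong (_* countPerms r R) countPerms-Q ⟨
    countPerms m Q * countPerms r R                  ∎
    where
    open ≡-Reasoning
    f = fibre (Vec.allFin r)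
    countPerms-Q : countPerms m Q ≡ r ! * f
    countPerms-Q = trans (countPerms-cong λ {σ} _ → sym (∧-identityʳ (Q σ)))
      (trans (countPerms-by-fibres (λ _ → true)) (cong (_* f) (countPerms-true r)))

  ℙ-block-independent : (R : Vec (Fin r) r → Bool) → ℙ m (λ σ → Q σ ∧ R (std s r σ)) ≡ ℙ m Q ℚ.* ℙ r R
  ℙ-block-independent R = sym (trans (frac-* (countPerms m Q) (m !) (countPerms r R) (r !) {{m !≢0}} {{r !≢0}})
    (frac-cong (countPerms m Q * countPerms r R) (m ! * r !) (countPerms m QR) (m !) {{m*n≢0 (m !) (r !) {{m !≢0}} {{r !≢0}}}} {{m !≢0}} (begin
      countPerms m Q * countPerms r R * m !         ≡⟨ cong (_* m !) (countPerms-block-independent R) ⟨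
      countPerms m QR * r ! * m !                   ≡⟨ *-assoc (countPerms m QR) (r !) (m !) ⟩
      countPerms m QR * (r ! * m !)                 ≡⟨ cong (countPerms m QR *_) (*-comm (r !) (m !)) ⟩
      countPerms m QR * (m ! * r !)                 ∎)))
    where
    open ≡-Reasoning
    QR = λ σ → Q σ ∧ R (std s r σ)

-- Occurrences of the pattern

module _ {d : ℕ} (v : Permutation′ d) where

  avoids : {m : ℕ} → Vec (Fin m) m → ℕ → ℕ → Bool
  avoids σ s zero    = true
  avoids σ s (suc k) = not (occursAtᵇ σ v s) ∧ avoids σ (suc s) k

  not-any-occurs≡avoids : {m : ℕ} (σ : Vec (Fin m) m) (f : ℕ → ℕ) (s k : ℕ) → (∀ j → f j ≡ s + j) →
                          not (any (occursAtᵇ σ v) (List.applyUpTo f k)) ≡ avoids σ s k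
  not-any-occurs≡avoids σ f s zero    f≗s+ = refl
  not-any-occurs≡avoids σ f s (suc k) f≗s+
    rewrite f≗s+ 0 | +-identityʳ s with occursAtᵇ σ v s
  ... | true  = refl
  ... | false = not-any-occurs≡avoids σ (f ∘ suc) (suc s) k (λ j → trans (f≗s+ (suc j)) (+-suc s j))

  not-contains≡avoids : {r : ℕ} (τ : Vec (Fin r) r) → d ≤ r → not (containsᵇ τ v) ≡ avoids τ 0 (suc (r ∸ d))
  not-contains≡avoids {r} τ d≤r rewrite Equivalence.to T-≡ (≤⇒≤ᵇ d≤r) =
    not-any-occurs≡avoids τ (λ j → j) 0 (suc (r ∸ d)) (λ _ → refl)

  avoids-+ : {m : ℕ} (σ : Vec (Fin m) m) (s a b : ℕ) → avoids σ s (a + b) ≡ avoids σ s a ∧ avoids σ (s + a) b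
  avoids-+ σ s zero    b = cong (λ t → avoids σ t b) (sym (+-identityʳ s))
  avoids-+ σ s (suc a) b = trans (cong (not (occursAtᵇ σ v s) ∧_) (trans (avoids-+ σ (suc s) a b)
    (cong (λ t → avoids σ (suc s) a ∧ avoids σ t b) (sym (+-suc s a))))) (sym (∧-assoc (not (occursAtᵇ σ v s)) _ _))

  avoids-suc : {m : ℕ} (σ : Vec (Fin m) m) (k : ℕ) → avoids σ 0 (suc k) ≡ avoids σ 0 k ∧ not (occursAtᵇ σ v k)
  avoids-suc σ k = trans (cong (avoids σ 0) (+-comm 1 k)) (trans (avoids-+ σ 0 k 1) (cong (avoids σ 0 k ∧_) (∧-identityʳ _)))

  occursAt-cong : {m m′ : ℕ} (σ : Vec (Fin m) m) (σ′ : Vec (Fin m′) m′) (j j′ : ℕ) →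
    (∀ p q → (nth σ (j + toℕ p) <ᵇ nth σ (j + toℕ q)) ≡ (nth σ′ (j′ + toℕ p) <ᵇ nth σ′ (j′ + toℕ q))) →
    occursAtᵇ σ v j ≡ occursAtᵇ σ′ v j′
  occursAt-cong σ σ′ j j′ same = cong and (map-cong (λ p → cong and (map-cong (λ q →
    cong (_== (toℕ (v ⟨$⟩ʳ p) <ᵇ toℕ (v ⟨$⟩ʳ q))) (same p q)) (allFin d))) (allFin d))

  occursAt-local : {m : ℕ} (σ σ′ : Vec (Fin m) m) (j : ℕ) → (∀ {p} → p < d → nth σ (j + p) ≡ nth σ′ (j + p)) →
                   occursAtᵇ σ v j ≡ occursAtᵇ σ′ v j
  occursAt-local σ σ′ j agree = occursAt-cong σ σ′ j j λ p q → cong₂ _<ᵇ_ (agree (Fin.toℕ<n p)) (agree (Fin.toℕ<n q))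

  occursAt-std : {m r : ℕ} (s : ℕ) (σ : Vec (Fin m) m) → InjectiveOn (window σ s) r → (j : ℕ) → j + d ≤ r →
                 occursAtᵇ (std s r σ) v j ≡ occursAtᵇ σ v (s + j)
  occursAt-std {r = r} s σ inj j j+d≤r = occursAt-cong (std s r σ) σ j (s + j) λ p q →
    trans (std-<ᵇ s σ inj (in-window p) (in-window q))
          (cong₂ (λ x y → nth σ x <ᵇ nth σ y) (sym (+-assoc s j (toℕ p))) (sym (+-assoc s j (toℕ q))))
    where
    in-window : (p : Fin d) → j + toℕ p < _
    in-window p = <-≤-trans (+-monoʳ-< j (Fin.toℕ<n p)) j+d≤r

  private
    window-bounds : {j k t : ℕ} → j + suc k + d ≤ suc t → j + d ≤ t × suc j + k + d ≤ suc t
    window-bounds {j} {k} {t} bound = ≤-trans (+-monoˡ-≤ d (m≤m+n j k)) (s≤s⁻¹ shifted) , shifted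
      where
      shifted : suc j + k + d ≤ suc t
      shifted = subst (_≤ suc t) (cong (_+ d) (+-suc j k)) bound

  avoids-std : {m r : ℕ} (s : ℕ) (σ : Vec (Fin m) m) → InjectiveOn (window σ s) r → (a k : ℕ) → a + k + d ≤ suc r →
               avoids (std s r σ) a k ≡ avoids σ (s + a) k
  avoids-std s σ inj a zero    _     = refl
  avoids-std s σ inj a (suc k) bound = cong₂ (λ x y → not x ∧ y) (occursAt-std s σ inj a (proj₁ (window-bounds bound)))
    (trans (avoids-std s σ inj (suc a) k (proj₂ (window-bounds bound))) (cong (λ t → avoids σ t k) (+-suc s a)))

  avoids-local : {m : ℕ} {σ σ′ : Vec (Fin m) m} {t : ℕ} → (∀ {i} → i < t → nth σ i ≡ nth σ′ i) → (j k : ℕ) → j + k + d ≤ suc t →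
                 avoids σ j k ≡ avoids σ′ j k
  avoids-local agree j zero    _     = refl
  avoids-local {σ = σ} {σ′} agree j (suc k) bound = cong₂ (λ x y → not x ∧ y)
    (occursAt-local σ σ′ j (λ p<d → agree (<-≤-trans (+-monoʳ-< j p<d) (proj₁ (window-bounds bound)))))
    (avoids-local agree (suc j) k (proj₂ (window-bounds bound)))

  private
    T-== : {a b : Bool} → T (a == b) → a ≡ b
    T-== {true}  {true}  _ = refl
    T-== {false} {false} _ = refl

    pattern-word : Vec (Fin d) d
    pattern-word = Vec.tabulate (v ⟨$⟩ʳ_)

    nth-pattern-word : (p : Fin d) → nth pattern-word (toℕ p) ≡ toℕ (v ⟨$⟩ʳ p)
    nth-pattern-word p = trans (nth-lookup pattern-word p) (cong toℕ (Vec.lookup∘tabulate _ p))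

    pattern-word-injective : Injectiveᵛ pattern-word
    pattern-word-injective {i} {j} eq = trans (sym (inverseˡ v)) (trans (cong (v ⟨$⟩ˡ_)
      (trans (sym (Vec.lookup∘tabulate _ i)) (trans eq (Vec.lookup∘tabulate _ j)))) (inverseˡ v))

    occursAt⇒comparisons : {m : ℕ} {σ : Vec (Fin m) m} {j : ℕ} → T (occursAtᵇ σ v j) →
      ∀ p q → (nth σ (j + toℕ p) <ᵇ nth σ (j + toℕ q)) ≡ (toℕ (v ⟨$⟩ʳ p) <ᵇ toℕ (v ⟨$⟩ʳ q))
    occursAt⇒comparisons {σ = σ} {j} occ p q =
      T-== (Equivalence.to (T-all-allFin {p = row p}) (Equivalence.to (T-all-allFin {p = λ p → all (row p) (allFin d)}) occ p) q)
      where
      row : Fin d → Fin d → Bool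
      row p q = (nth σ (j + toℕ p) <ᵇ nth σ (j + toℕ q)) == (toℕ (v ⟨$⟩ʳ p) <ᵇ toℕ (v ⟨$⟩ʳ q))

    occursAt-0⇒pattern-word : {τ : Vec (Fin d) d} → Injectiveᵛ τ → T (occursAtᵇ τ v 0) → τ ≡ pattern-word
    occursAt-0⇒pattern-word {τ} inj occ = begin
      τ                      ≡⟨ std-of-injective inj ⟨
      std 0 d τ              ≡⟨ std-cong 0 0 τ pattern-word same-comparisons ⟩
      std 0 d pattern-word   ≡⟨ std-of-injective pattern-word-injective ⟩
      pattern-word           ∎
      where
      open ≡-Reasoning
      same-comparisons : ∀ {a b} → a < d → b < d → (nth τ a <ᵇ nth τ b) ≡ (nth pattern-word a <ᵇ nth pattern-word b)
      same-comparisons a<d b<d = subst₂ (λ a b → (nth τ a <ᵇ nth τ b) ≡ (nth pattern-word a <ᵇ nth pattern-word b))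
        (Fin.toℕ-fromℕ< a<d) (Fin.toℕ-fromℕ< b<d)
        (trans (occursAt⇒comparisons {σ = τ} occ _ _)
               (sym (cong₂ _<ᵇ_ (nth-pattern-word _) (nth-pattern-word _))))

  countPerms-occursAt-0 : countPerms d (λ τ → occursAtᵇ τ v 0) ≤ 1
  countPerms-occursAt-0 = begin
    countPerms d (λ τ → occursAtᵇ τ v 0)                 ≤⟨ count-mono (perms d) (λ τ∈ occ → fromWitness
                                                              (sym (occursAt-0⇒pattern-word (Equivalence.to ∈-perms τ∈) occ))) ⟩
    count (λ τ → isYes (pattern-word ≟ᵛ τ)) (perms d)    ≡⟨ count-≟-unique _≟ᵛ_ (perms-unique d)
                                                              (Equivalence.from ∈-perms pattern-word-injective) ⟩
    1                                                    ∎
    where open ≤-Reasoning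

  firstOccurrenceAt : {m : ℕ} → Vec (Fin m) m → ℕ → Bool
  firstOccurrenceAt σ j = avoids σ 0 j ∧ occursAtᵇ σ v j

  ℙ-avoids-suc : (m j : ℕ) → ℙ m (λ σ → avoids σ 0 j) ≡ ℙ m (λ σ → firstOccurrenceAt σ j) ℚ.+ ℙ m (λ σ → avoids σ 0 (suc j))
  ℙ-avoids-suc m j = trans (ℙ-split {m} _ (λ σ → occursAtᵇ σ v j)) (cong (ℙ m (λ σ → firstOccurrenceAt σ j) ℚ.+_)
    (ℙ-cong {m} (λ {σ} _ → sym (avoids-suc σ j))))

  occurs-if-not-avoids : {m : ℕ} (σ : Vec (Fin m) m) (s k : ℕ) → T (not (avoids σ s k)) → ∃ λ j → j < k × T (occursAtᵇ σ v (s + j))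
  occurs-if-not-avoids σ s (suc k) hit with occursAtᵇ σ v s in occ
  ... | true  = 0 , s≤s z≤n , subst T (sym (trans (cong (occursAtᵇ σ v) (+-identityʳ s)) occ)) tt
  ... | false with j , j<k , occ′ ← occurs-if-not-avoids σ (suc s) k hit =
    suc j , s≤s j<k , subst (T ∘ occursAtᵇ σ v) (sym (+-suc s j)) occ′

module _ {d′ : ℕ} (v : Permutation′ (suc d′)) where

  a≡ℙ-avoids : {w : ℕ} (m : ℕ) → 1 ≤ w → w + d′ ≤ m → a v w ≡ ℙ m (λ σ → avoids v σ 0 w)
  a≡ℙ-avoids {suc w} m _ k≤m = begin
    a v (suc w)                                   ≡⟨ cong (λ x → frac (g0 v x) (x !) {{x !≢0}}) (+-suc w d′) ⟩
    frac (g0 v k) (k !) {{k !≢0}}                 ≡⟨ cong (λ c → frac c (k !) {{k !≢0}}) (g0≡countPerms v k) ⟩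
    ℙ k (λ τ → not (containsᵇ τ v))               ≡⟨ ℙ-cong (λ {τ} _ → trans (not-contains≡avoids v τ (s≤s (m≤n+m d′ w)))
                                                       (cong (avoids v τ 0 ∘ suc) (m+n∸n≡m w d′))) ⟩
    ℙ k R                                         ≡⟨ ℚ.*-identityˡ (ℙ k R) ⟨
    1ℚ ℚ.* ℙ k R                                  ≡⟨ cong (ℚ._* ℙ k R) (ℙ-true m) ⟨
    ℙ m (λ _ → true) ℚ.* ℙ k R                    ≡⟨ ℙ-block-independent 0 k≤m (λ _ → true) (λ _ → refl) R ⟨
    ℙ m (λ σ → R (std 0 k σ))                     ≡⟨ ℙ-cong (λ {σ} inj → avoids-std v 0 σ (nth-injectiveOn {σ = σ} inj 0 k k≤m) 0 (suc w)
                                                       (≤-reflexive (+-suc (suc w) d′))) ⟩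
    ℙ m (λ σ → avoids v σ 0 (suc w))              ∎
    where
    open ≡-Reasoning
    k = suc w + d′
    R : Vec (Fin k) k → Bool
    R τ = avoids v τ 0 (suc w)

-- Positions of σ ∈ S_m run from 0 to last; the gap is w₁, …, k − 1 and the final block starts at k.
module Sandwich {d′ : ℕ} (v : Permutation′ (suc d′)) (w₂ ℓ₁ : ℕ) where

  d w₁ k L m last : ℕ
  d    = suc d′
  w₁   = w₂ + d′
  k    = w₁ + d′
  L    = suc ℓ₁ + d′
  m    = k + L
  last = k + ℓ₁

  avoidsPrefix₁ avoidsPrefix₂ firstAtLast firstAtLastOutsideGap : Vec (Fin m) m → Bool
  avoidsPrefix₁ σ = avoids v σ 0 w₁
  avoidsPrefix₂ σ = avoids v σ 0 w₂
  firstAtLast σ = firstOccurrenceAt v σ last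
  firstAtLastOutsideGap σ = avoidsPrefix₁ σ ∧ firstOccurrenceAt v (std k L σ) ℓ₁

  gapFree tail : Vec (Fin m) m → Bool
  gapFree σ = avoids v σ w₁ d′
  tail σ = avoids v σ k ℓ₁ ∧ occursAtᵇ σ v last

  firstAtLast-split : (σ : Vec (Fin m) m) → firstAtLast σ ≡ avoidsPrefix₁ σ ∧ (gapFree σ ∧ tail σ)
  firstAtLast-split σ =
    trans (cong (_∧ occursAtᵇ σ v last) (trans (avoids-+ v σ 0 k ℓ₁) (cong (_∧ avoids v σ k ℓ₁) (avoids-+ v σ 0 w₁ d′))))
          (trans (∧-assoc (avoidsPrefix₁ σ ∧ gapFree σ) _ _) (∧-assoc (avoidsPrefix₁ σ) (gapFree σ) _))

  firstAtLastOutsideGap-split : {σ : Vec (Fin m) m} → Injectiveᵛ σ → firstAtLastOutsideGap σ ≡ avoidsPrefix₁ σ ∧ tail σ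
  firstAtLastOutsideGap-split {σ} inj = cong (avoidsPrefix₁ σ ∧_) (cong₂ _∧_
    (trans (avoids-std v k σ block-injective 0 ℓ₁ (≤-trans (≤-reflexive (+-suc ℓ₁ d′)) (n≤1+n L)))
           (cong (λ s → avoids v σ s ℓ₁) (+-identityʳ k)))
    (occursAt-std v k σ block-injective ℓ₁ (≤-reflexive (+-suc ℓ₁ d′))))
    where
    block-injective : InjectiveOn (window σ k) L
    block-injective = nth-injectiveOn {σ = σ} inj k L ≤-refl

  countPerms-firstAtLast≤ : countPerms m firstAtLast ≤ countPerms m firstAtLastOutsideGap
  countPerms-firstAtLast≤ = countPerms-mono λ {σ} inj first → subst T (sym (firstAtLastOutsideGap-split inj))
    (drop-middle (avoidsPrefix₁ σ) (gapFree σ) (tail σ) (subst T (firstAtLast-split σ) first))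
    where
    drop-middle : (a b c : Bool) → T (a ∧ (b ∧ c)) → T (a ∧ c)
    drop-middle true true  _ t = t

  firstAtLastOutsideGap∧gapFree : {σ : Vec (Fin m) m} → Injectiveᵛ σ → firstAtLastOutsideGap σ ∧ gapFree σ ≡ firstAtLast σ
  firstAtLastOutsideGap∧gapFree {σ} inj = begin
    firstAtLastOutsideGap σ ∧ gapFree σ        ≡⟨ cong (_∧ gapFree σ) (firstAtLastOutsideGap-split inj) ⟩
    (avoidsPrefix₁ σ ∧ tail σ) ∧ gapFree σ     ≡⟨ ∧-assoc (avoidsPrefix₁ σ) (tail σ) (gapFree σ) ⟩
    avoidsPrefix₁ σ ∧ (tail σ ∧ gapFree σ)     ≡⟨ cong (avoidsPrefix₁ σ ∧_) (∧-comm (tail σ) (gapFree σ)) ⟩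
    avoidsPrefix₁ σ ∧ (gapFree σ ∧ tail σ)     ≡⟨ firstAtLast-split σ ⟨
    firstAtLast σ                              ∎
    where open ≡-Reasoning

  gapOccurrence : ℕ → Vec (Fin m) m → Bool
  gapOccurrence j σ = avoidsPrefix₂ σ ∧ occursAtᵇ σ v (w₁ + j)

  countPerms-firstAtLastOutsideGap≤ :
    countPerms m firstAtLastOutsideGap ≤ countPerms m firstAtLast + ∑ (λ j → countPerms m (gapOccurrence j)) (upTo d′)
  countPerms-firstAtLastOutsideGap≤ = begin
    countPerms m firstAtLastOutsideGap
      ≡⟨ count-∧-not firstAtLastOutsideGap gapFree (perms m) ⟩
    countPerms m (λ σ → firstAtLastOutsideGap σ ∧ gapFree σ) + countPerms m (λ σ → firstAtLastOutsideGap σ ∧ not (gapFree σ))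
      ≤⟨ +-mono-≤ (≤-reflexive (countPerms-cong firstAtLastOutsideGap∧gapFree)) (countPerms-mono without-gapFree) ⟩
    countPerms m firstAtLast + countPerms m (λ σ → any (λ j → gapOccurrence j σ) (upTo d′))
      ≤⟨ +-monoʳ-≤ (countPerms m firstAtLast) (count-any gapOccurrence (upTo d′) (perms m)) ⟩
    countPerms m firstAtLast + ∑ (λ j → countPerms m (gapOccurrence j)) (upTo d′)
      ∎
    where
    open ≤-Reasoning
    without-gapFree : ∀ {σ} → Injectiveᵛ σ → T (firstAtLastOutsideGap σ ∧ not (gapFree σ)) → T (any (λ j → gapOccurrence j σ) (upTo d′))
    without-gapFree {σ} inj t with outside , gap-hit ← Equivalence.to T-∧ t
                              with j , j<d′ , occ ← occurs-if-not-avoids v σ w₁ d′ gap-hit =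
      any⁺ (λ j → gapOccurrence j σ) (Any.map (λ { refl → Equivalence.from T-∧ (prefix₂ , occ) }) (∈-upTo⁺ j<d′))
      where
      prefix₂ : T (avoidsPrefix₂ σ)
      prefix₂ = proj₁ (Equivalence.to T-∧ (subst T (avoids-+ v σ 0 w₂ d′)
                  (proj₁ (Equivalence.to T-∧ (subst T (firstAtLastOutsideGap-split inj) outside)))))

  countPerms-gapOccurrence : {j : ℕ} → j < d′ → countPerms m (gapOccurrence j) * d ! ≤ countPerms m avoidsPrefix₂
  countPerms-gapOccurrence {j} j<d′ = begin
    countPerms m (gapOccurrence j) * d !                                     ≡⟨ cong (_* d !) (countPerms-cong pattern-block) ⟩
    countPerms m (λ σ → avoidsPrefix₂ σ ∧ occursAtᵇ (std s d σ) v 0) * d !  ≡⟨ countPerms-block-independent s block-fits avoidsPrefix₂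
                                                                                 (λ agree → avoids-local v agree 0 w₂ prefix-fits) (λ τ → occursAtᵇ τ v 0) ⟩
    countPerms m avoidsPrefix₂ * countPerms d (λ τ → occursAtᵇ τ v 0)        ≤⟨ *-monoʳ-≤ (countPerms m avoidsPrefix₂) (countPerms-occursAt-0 v) ⟩
    countPerms m avoidsPrefix₂ * 1                                           ≡⟨ *-identityʳ _ ⟩
    countPerms m avoidsPrefix₂                                               ∎
    where
    open ≤-Reasoning
    s = w₁ + j
    block-fits : s + d ≤ m
    block-fits = begin
      w₁ + j + d         ≡⟨ +-assoc w₁ j d ⟩
      w₁ + (j + d)       ≤⟨ +-monoʳ-≤ w₁ (+-mono-≤ (<⇒≤ j<d′) (s≤s (m≤n+m d′ ℓ₁))) ⟩
      w₁ + (d′ + L)      ≡⟨ +-assoc w₁ d′ L ⟨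
      m                  ∎
    prefix-fits : 0 + w₂ + d ≤ suc s
    prefix-fits = ≤-trans (≤-reflexive (+-suc w₂ d′)) (s≤s (m≤m+n w₁ j))
    pattern-block : ∀ {σ} → Injectiveᵛ σ → gapOccurrence j σ ≡ avoidsPrefix₂ σ ∧ occursAtᵇ (std s d σ) v 0
    pattern-block {σ} inj = cong (avoidsPrefix₂ σ ∧_) (sym (trans (occursAt-std v s σ (nth-injectiveOn {σ = σ} inj s d block-fits) 0 ≤-refl)
                                                          (cong (occursAtᵇ σ v) (+-identityʳ s))))

  excess : ℕ
  excess = countPerms m firstAtLastOutsideGap ∸ countPerms m firstAtLast

  countPerms-gap : excess * d ! ≤ d′ * countPerms m avoidsPrefix₂
  countPerms-gap = ≤-trans
    (*-monoˡ-≤ (d !) (m≤n+o⇒m∸n≤o (countPerms m firstAtLastOutsideGap) (countPerms m firstAtLast) countPerms-firstAtLastOutsideGap≤))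
    (∑-upTo-*-≤ (λ j → countPerms m (gapOccurrence j)) (d !) (countPerms m avoidsPrefix₂) d′ countPerms-gapOccurrence)

  private
    last+1+d′≡m : suc last + d′ ≡ m
    last+1+d′≡m = sym (trans (+-suc k (ℓ₁ + d′)) (cong suc (sym (+-assoc k ℓ₁ d′))))

  difference≡excess : 1 ≤ w₂ → 1 ≤ ℓ₁ →
    (a v (suc last) ℚ.- a v last) ℚ.+ β v (suc ℓ₁) ℚ.* a v w₁ ≡ frac excess (m !) {{m !≢0}}
  difference≡excess 1≤w₂ 1≤ℓ₁ = begin
    (a v (suc last) ℚ.- a v last) ℚ.+ β v (suc ℓ₁) ℚ.* a v w₁
      ≡⟨ cong₂ ℚ._+_ (cong₂ ℚ._-_ (a≡ℙ-avoids v m (s≤s z≤n) (≤-reflexive last+1+d′≡m))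
                                   (trans (a≡ℙ-avoids v m (≤-trans 1≤ℓ₁ (m≤n+m ℓ₁ k)) (≤-trans (n≤1+n _) (≤-reflexive last+1+d′≡m)))
                                          (ℙ-avoids-suc v m last)))
                     (cong₂ ℚ._*_ (cong₂ ℚ._-_ (trans (a≡ℙ-avoids v L 1≤ℓ₁ (n≤1+n _)) (ℙ-avoids-suc v L ℓ₁))
                                               (a≡ℙ-avoids v L (s≤s z≤n) ≤-refl))
                                  (a≡ℙ-avoids v m (≤-trans 1≤w₂ (m≤m+n w₂ d′)) (m≤m+n k L))) ⟩
    (none ℚ.- (first ℚ.+ none)) ℚ.+ ((block ℚ.+ noneᴸ) ℚ.- noneᴸ) ℚ.* prefix
      ≡⟨ solve 5 (λ n f b n′ p → (n :- (f :+ n)) :+ ((b :+ n′) :- n′) :* p := b :* p :- f) refl none first block noneᴸ prefix ⟩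
    block ℚ.* prefix ℚ.- first
      ≡⟨ cong (ℚ._- first) (trans (ℚ.*-comm block prefix) (sym (ℙ-block-independent k ≤-refl avoidsPrefix₁
           (λ agree → avoids-local v agree 0 w₁ (≤-reflexive (+-suc w₁ d′))) (λ τ → firstOccurrenceAt v τ ℓ₁)))) ⟩
    ℙ m firstAtLastOutsideGap ℚ.- first
      ≡⟨ ℙ-difference {m} {firstAtLast} {firstAtLastOutsideGap} countPerms-firstAtLast≤ ⟩
    frac excess (m !) {{m !≢0}}
      ∎
    where
    open ≡-Reasoning
    open ℚ-Solver
    first = ℙ m firstAtLast
    none = ℙ m (λ σ → avoids v σ 0 (suc last))
    block = ℙ L (λ τ → firstOccurrenceAt v τ ℓ₁)
    noneᴸ = ℙ L (λ τ → avoids v τ 0 (suc ℓ₁))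
    prefix = ℙ m avoidsPrefix₁

  -- Stated with the index expressions of theorem4 verbatim: a conversion check between
  -- a v x and a v y for syntactically different x, y would unfold a and enumerate permutations.
  sandwich : (n i j : ℕ) → n ≡ suc last → i ≡ w₁ → j ≡ w₂ → 1 ≤ w₂ → 1 ≤ ℓ₁ →
    (0ℚ ℚ.≤ ((a v n ℚ.- a v (n ∸ 1)) ℚ.+ β v (suc ℓ₁) ℚ.* a v i))
    × (((a v n ℚ.- a v (n ∸ 1)) ℚ.+ β v (suc ℓ₁) ℚ.* a v i)
        ℚ.≤ (_/_ (ℤ.+ (suc d′ ∸ 1)) (suc d′ !) {{suc d′ !≢0}}) ℚ.* a v j)
  sandwich _ _ _ refl refl refl 1≤w₂ 1≤ℓ₁ =
    subst (0ℚ ℚ.≤_) (sym (difference≡excess 1≤w₂ 1≤ℓ₁)) (frac-nonNegative excess (m !) {{m !≢0}}) ,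
    subst₂ ℚ._≤_ (sym (difference≡excess 1≤w₂ 1≤ℓ₁)) (sym bound≡)
      (frac-mono-≤ excess (m !) (d′ * countPerms m avoidsPrefix₂) (d ! * m !) {{m !≢0}} {{m*n≢0 (d !) (m !) {{d !≢0}} {{m !≢0}}}}
        (≤-trans (≤-reflexive (sym (*-assoc excess (d !) (m !)))) (*-monoˡ-≤ (m !) countPerms-gap)))
    where
    bound≡ : frac d′ (d !) {{d !≢0}} ℚ.* a v w₂ ≡ frac (d′ * countPerms m avoidsPrefix₂) (d ! * m !) {{m*n≢0 (d !) (m !) {{d !≢0}} {{m !≢0}}}}
    bound≡ = trans (cong (frac d′ (d !) {{d !≢0}} ℚ.*_) (a≡ℙ-avoids v m 1≤w₂ (≤-trans (m≤m+n w₁ d′) (m≤m+n k L))))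
                   (frac-* d′ (d !) _ (m !) {{d !≢0}} {{m !≢0}})

-- From n = ℓ + 2d + 1 + o; the sandwich is applied with w₂ = o + 3.
sandwich-indices : (d′ ℓ₁ o n : ℕ) → suc (suc ℓ₁ + 2 * suc d′) + o ≡ n →
    n ≡ suc (suc o + 2 + d′ + d′ + ℓ₁)
  × n ∸ suc ℓ₁ ∸ suc d′ + 1 ≡ suc o + 2 + d′
  × n ∸ suc ℓ₁ ∸ 2 * suc d′ + 2 ≡ suc o + 2
sandwich-indices d′ ℓ₁ o n refl = solve 3 (λ l e o → con 1 :+ ((con 1 :+ l) :+ con 2 :* (con 1 :+ e)) :+ o
                                   := con 1 :+ ((((con 1 :+ o) :+ con 2) :+ e) :+ e :+ l)) refl ℓ₁ d′ o
                                , gap , cong (_+ 2) (trans (cong (_∸ 2 * d) n∸ℓ) (m+n∸m≡n (2 * d) (suc o)))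
  where
  open +-*-Solver
  d = suc d′
  n∸ℓ : suc (suc ℓ₁ + 2 * d) + o ∸ suc ℓ₁ ≡ 2 * d + suc o
  n∸ℓ = trans (cong (_∸ suc ℓ₁) (solve 3 (λ l e o → con 1 :+ ((con 1 :+ l) :+ con 2 :* (con 1 :+ e)) :+ o
                                          := (con 1 :+ l) :+ (con 2 :* (con 1 :+ e) :+ (con 1 :+ o))) refl ℓ₁ d′ o))
              (m+n∸m≡n (suc ℓ₁) _)
  gap : suc (suc ℓ₁ + 2 * d) + o ∸ suc ℓ₁ ∸ d + 1 ≡ suc o + 2 + d′
  gap = begin
    suc (suc ℓ₁ + 2 * d) + o ∸ suc ℓ₁ ∸ d + 1   ≡⟨ cong (λ x → x ∸ d + 1) n∸ℓ ⟩
    2 * d + suc o ∸ d + 1                       ≡⟨ cong (λ x → x ∸ d + 1) (solve 2 (λ e o → con 2 :* (con 1 :+ e) :+ (con 1 :+ o)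
                                                     := (con 1 :+ e) :+ ((con 1 :+ e) :+ (con 1 :+ o))) refl d′ o) ⟩
    d + (d + suc o) ∸ d + 1                     ≡⟨ cong (_+ 1) (m+n∸m≡n d (d + suc o)) ⟩
    d + suc o + 1                               ≡⟨ solve 2 (λ e o → (con 1 :+ e) :+ (con 1 :+ o) :+ con 1
                                                     := (con 1 :+ o) :+ con 2 :+ e) refl d′ o ⟩
    suc o + 2 + d′                              ∎
    where open ≡-Reasoning

-- The empty pattern occurs at every position (occursAtᵇ is an empty conjunction).
a-empty-pattern : (v : Permutation′ 0) (x : ℕ) → a v x ≡ 0ℚ
a-empty-pattern v x = trans (cong (λ c → frac c (k !) {{k !≢0}}) (trans (g0≡countPerms v k) (∑-0 (perms k))))
  (ℚ.0/n≡0 (k !) {{k !≢0}})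
  where k = x + 0 ∸ 1

open import Data.Integer.Base using (+_)
open import Data.Rational.Base using (_-_)
import Data.Rational.Base as Q

theorem4 : (d : ℕ) (v : Permutation′ d) (ℓ : ℕ) → 2 ≤ ℓ → (n : ℕ) → ℓ + 2 * d < n →
  (0ℚ Q.≤ ((a v n - a v (n ∸ 1)) Q.+ β v ℓ Q.* a v (n ∸ ℓ ∸ d + 1)))
  × (((a v n - a v (n ∸ 1)) Q.+ β v ℓ Q.* a v (n ∸ ℓ ∸ d + 1))
      Q.≤ (_/_ (+ (d ∸ 1)) (d !) {{d !≢0}}) Q.* a v (n ∸ ℓ ∸ 2 * d + 2))
theorem4 zero v ℓ _ n _ = subst (0ℚ Q.≤_) (sym E≡0) (ℚ.≤-refl {0ℚ}) , subst₂ Q._≤_ (sym E≡0) (sym U≡0) (ℚ.≤-refl {0ℚ})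
  where
  a₀ = a-empty-pattern v
  E≡0 : (a v n - a v (n ∸ 1)) Q.+ β v ℓ Q.* a v (n ∸ ℓ ∸ 0 + 1) ≡ 0ℚ
  E≡0 = cong₂ Q._+_ (cong₂ _-_ (a₀ n) (a₀ (n ∸ 1))) (cong₂ Q._*_ (cong₂ _-_ (a₀ (ℓ ∸ 1)) (a₀ ℓ)) (a₀ (n ∸ ℓ ∸ 0 + 1)))
  U≡0 : (_/_ (+ (0 ∸ 1)) (0 !) {{0 !≢0}}) Q.* a v (n ∸ ℓ ∸ 2 * 0 + 2) ≡ 0ℚ
  U≡0 = cong ((_/_ (+ (0 ∸ 1)) (0 !) {{0 !≢0}}) Q.*_) (a₀ (n ∸ ℓ ∸ 2 * 0 + 2))
theorem4 (suc d′) v (suc ℓ₁) (s≤s 1≤ℓ₁) n ℓ+2d<n =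
  Sandwich.sandwich v (suc o + 2) ℓ₁ n _ _ n≡ gap≡ prefix≡ (s≤s z≤n) 1≤ℓ₁
  where
  o = proj₁ (m≤n⇒∃[o]m+o≡n ℓ+2d<n)
  indices = sandwich-indices d′ ℓ₁ o n (proj₂ (m≤n⇒∃[o]m+o≡n ℓ+2d<n))
  n≡ = proj₁ indices
  gap≡ = proj₁ (proj₂ indices)
  prefix≡ = proj₂ (proj₂ indices)
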